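{- Let $G$ be a charged signed graph that is equivalent to a connected (induced) subgraph of one of $T_{2k}$ ($k\ge3$), $C_{2k}^{++}$ or $C_{2k}^{+- }$ ($k\ge2$). If $G$ has path rank at least $5$, then its path rank equals its profile rank, and the columns of its profile are uniquely determined. Moreover, the order of the columns is determined up to reversal or (for a cycling profile) cyclic shift.
   Context: A charged signed graph is a graph whose edges carry signs $\pm1$ and whose vertices carry charges in $\{ -1,0,1\}$ (neutral if charge $0$); its adjacency matrix is the symmetric matrix with the charges on the diagonal and the edge signs off the diagonal. Subgraphs are induced subgraphs. Two charged signed graphs are equivalent if their adjacency matrices $A,B$ satisfy $B=\pm P^TAP$ for a signed permutation matrix $P$. The graphs: $T_{2k}$ ($k\ge 3$) has vertices $u_i,w_i$, $i\in\mathbb Z/k\mathbb Z$, all neutral, with positive edges $u_iu_{i+1}$ and $u_iw_{i+1}$, and negative edges $w_iw_{i+1}$ and $w_iu_{i+1}$, for all $i$. $C_{2k}^{++}$ and $C_{2k}^{+- }$ ($k\ge 2$) have vertices $u_i,w_i$, $1\le i\le k$, with positive edges $u_iu_{i+1}$, $u_iw_{i+1}$ and negative edges $w_iw_{i+1}$, $w_iu_{i+1}$ for $1\le i<k$, and a positive edge $u_1w_1$ with $u_1,w_1$ of charge $+1$, vertices $u_i,w_i$ neutral for $1<i<k$; in $C_{2k}^{++}$, $u_k,w_k$ have charge $+1$ and $u_kw_k$ is a negative edge; in $C_{2k}^{+- }$, $u_k,w_k$ have charge $-1$ and $u_kw_k$ is a positive edge. A profile of a charged signed graph is a partition of its vertex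 set into a sequence of $k\ge3$ subsets (columns) $V_1,\dots,V_k$, each containing one or two vertices, each column consisting only of neutral vertices or only of charged vertices all of the same charge, such that either (non-cycling) $xy$ is an edge iff $x,y$ lie in consecutive columns $V_i,V_{i+1}$ or are charged vertices in the same column, or (cycling) the same holds with $V_k,V_1$ also counted as consecutive. The profile rank is the number of columns. (The graphs $T_{2k}$, $C_{2k}^{\pm\pm}$ have profiles with columns $\{u_i,w_i\}$, and their connected subgraphs inherit profiles.) A chordless path (resp. cycle) is a path (resp. cycle) $P$ such that any two vertices of $P$ adjacent in the graph are adjacent in $P$. The path rank is the maximum number of vertices of a chordless path or chordless cycle. -}

module Defs where

open import Data.Nat using (ℕ; zero; suc; _+_; _≤_; _<_; _≡ᵇ_)
open import Data.Bool using (Bool; true; false; if_then_else_; _∨_; _∧_)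
open import Data.Fin using (Fin; toℕ)
open import Data.Fin.Permutation using (Permutation′; _⟨$⟩ʳ_)
open import Data.Product using (Σ; Σ-syntax; _×_; _,_)
open import Data.Sum using (_⊎_)
open import Data.Unit using (⊤)
open import Function.Bundles using (_⇔_)
open import Function.Definitions using (Injective)
open import Relation.Binary.PropositionalEquality using (_≡_; _≢_)

data Tri : Set where
  neg zer pos : Tri

data Sign : Set where
  plus minus : Sign

act : Sign → Tri → Tri
act plus  t   = t
act minus neg = pos
act minus zer = zer
act minus pos = neg

-- Charged signed graphs on a vertex type V, given by their adjacency
-- matrix: diagonal = charges, off-diagonal = edge signs (zer = no edge).

Matrix : Set → Set
Matrix V = V → V → Tri

-- A matrix is the adjacency matrix of a charged signed graph iff it is
-- symmetric (entries are automatically in {-1,0,1}).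
IsCSG : {V : Set} → Matrix V → Set
IsCSG {V} A = ∀ (x y : V) → A x y ≡ A y x

charge : {V : Set} → Matrix V → V → Tri
charge A x = A x x

Edge : {V : Set} → Matrix V → V → V → Set
Edge A x y = (x ≢ y) × (A x y ≢ zer)

-- Equivalence: B = ± Pᵀ A P for a signed permutation matrix P, written
-- out entrywise: (±PᵀAP)ᵢⱼ = ε sᵢ sⱼ A_{σ i, σ j}.
Equivalent : {n : ℕ} → Matrix (Fin n) → Matrix (Fin n) → Set
Equivalent {n} B A =
  Σ[ σ ∈ Permutation′ n ] Σ[ ε ∈ Sign ] Σ[ s ∈ (Fin n → Sign) ]
    (∀ i j → B i j ≡ act ε (act (s i) (act (s j) (A (σ ⟨$⟩ʳ i) (σ ⟨$⟩ʳ j)))))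

Induced : {V : Set} {n : ℕ} → Matrix V → (Fin n → V) → Matrix (Fin n)
Induced A ι i j = A (ι i) (ι j)

data Reach {V : Set} (A : Matrix V) : V → V → Set where
  here : ∀ {x} → Reach A x x
  step : ∀ {x y z} → Edge A x y → Reach A y z → Reach A x z

Connected : {V : Set} → Matrix V → Set
Connected {V} A = ∀ (x y : V) → Reach A x y

-- The graphs T_{2k}, C_{2k}^{++}, C_{2k}^{+-}.
-- Vertex set Fin k × Bool: (i , false) = u_i, (i , true) = w_i.
-- (For C graphs, Fin index i stands for the paper's index i+1.)

linSucc : {k : ℕ} → Fin k → Fin k → Bool
linSucc i j = suc (toℕ i) ≡ᵇ toℕ j

cycSucc : (k : ℕ) → Fin k → Fin k → Bool
cycSucc k i j = linSucc i j ∨ ((suc (toℕ i) ≡ᵇ k) ∧ (toℕ j ≡ᵇ 0))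

-- sign of edges out of u_i (positive) / w_i (negative) towards column i+1
outSign : Bool → Tri
outSign false = pos
outSign true  = neg

T : (k : ℕ) → Matrix (Fin k × Bool)
T k (i , a) (j , b) =
  if cycSucc k i j then outSign a
  else if cycSucc k j i then outSign b
  else zer

-- generic C_{2k} with given charge c of u_k,w_k and sign e of u_k w_k
Cgen : Tri → Tri → (k : ℕ) → Matrix (Fin k × Bool)
Cgen c e k (i , a) (j , b) =
  if linSucc i j then outSign a
  else if linSucc j i then outSign b
  else if toℕ i ≡ᵇ toℕ j then
    (if toℕ i ≡ᵇ 0 then pos
     else if suc (toℕ i) ≡ᵇ k then (if eqB a b then c else e)
     else zer)
  else zer
  where
  eqB : Bool → Bool → Bool
  eqB false false = true
  eqB true  true  = true
  eqB _     _     = false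

Cpp : (k : ℕ) → Matrix (Fin k × Bool)
Cpp = Cgen pos neg

Cpm : (k : ℕ) → Matrix (Fin k × Bool)
Cpm = Cgen neg pos

EquivConnSub : {n : ℕ} {V : Set} → Matrix (Fin n) → Matrix V → Set
EquivConnSub {n} {V} G H =
  Σ[ ι ∈ (Fin n → V) ] Injective _≡_ _≡_ ι
    × Connected (Induced H ι) × Equivalent G (Induced H ι)

LinAdj : {r : ℕ} → Fin r → Fin r → Set
LinAdj i j = (suc (toℕ i) ≡ toℕ j) ⊎ (suc (toℕ j) ≡ toℕ i)

CycAdj : (r : ℕ) → Fin r → Fin r → Set
CycAdj r i j = LinAdj i j
  ⊎ ((toℕ i ≡ 0) × (suc (toℕ j) ≡ r))
  ⊎ ((toℕ j ≡ 0) × (suc (toℕ i) ≡ r))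

ChordlessPath : {n : ℕ} → Matrix (Fin n) → ℕ → Set
ChordlessPath {n} G r =
  Σ[ v ∈ (Fin r → Fin n) ] Injective _≡_ _≡_ v
    × (∀ i j → Edge G (v i) (v j) ⇔ LinAdj i j)

ChordlessCycle : {n : ℕ} → Matrix (Fin n) → ℕ → Set
ChordlessCycle {n} G r = (3 ≤ r) ×
  (Σ[ v ∈ (Fin r → Fin n) ] Injective _≡_ _≡_ v
    × (∀ i j → Edge G (v i) (v j) ⇔ CycAdj r i j))

HasChordless : {n : ℕ} → Matrix (Fin n) → ℕ → Set
HasChordless G r = ChordlessPath G r ⊎ ChordlessCycle G r

PathRank : {n : ℕ} → Matrix (Fin n) → ℕ → Set
PathRank G r = HasChordless G r × (∀ r′ → HasChordless G r′ → r′ ≤ r)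

ColAdj : Bool → (k : ℕ) → Fin k → Fin k → Set
ColAdj false k i j = LinAdj i j
ColAdj true  k i j = CycAdj k i j

record Profile {n : ℕ} (G : Matrix (Fin n)) (k : ℕ) : Set where
  field
    col       : Fin n → Fin k
    cycling   : Bool
    three≤k   : 3 ≤ k
    nonempty  : ∀ (i : Fin k) → Σ[ x ∈ Fin n ] col x ≡ i
    atMostTwo : ∀ x y z → col x ≡ col y → col y ≡ col z →
                  (x ≡ y) ⊎ (y ≡ z) ⊎ (x ≡ z)
    uniform   : ∀ x y → col x ≡ col y → charge G x ≡ charge G y
    edges     : ∀ x y → x ≢ y →
                  Edge G x y ⇔
                    (ColAdj cycling k (col x) (col y)
                      ⊎ ((col x ≡ col y) × (charge G x ≢ zer)))

open Profile public

-- φ : Fin r → Fin r is the identity or the reversal, or, for a cycling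
-- profile, any dihedral symmetry (cyclic shift, possibly with reversal).
Reorder : Bool → (r : ℕ) → (Fin r → Fin r) → Set
Reorder cyc r φ =
  (∀ i → φ i ≡ i)
  ⊎ (∀ i → toℕ (φ i) + toℕ i + 1 ≡ r)
  ⊎ ((cyc ≡ true) × (Σ[ c ∈ ℕ ] (c < r) ×
       ((∀ i → (toℕ (φ i) ≡ toℕ i + c) ⊎ (toℕ (φ i) + r ≡ toℕ i + c))
        ⊎ (∀ i → (toℕ (φ i) + toℕ i ≡ c) ⊎ (toℕ (φ i) + toℕ i ≡ c + r)))))

module Submission where

-- The key fact: on a chordless path or cycle with at least five vertices, any two
-- vertices are told apart by a third one adjacent to exactly one of them
-- (pathSeparated, cycleSeparated), so a colouring in which equally coloured
-- vertices are twins is injective along it (twins-injective).  Profile columns,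
-- and more generally the columns of a column map, are such colourings.  Hence:
--   * rank: representatives of the k columns of a profile form a chordless path
--     or cycle, so k ≤ r, and a longest one meets every column once, so r ≤ k;
--   * uniqueness: two profiles have the same columns (sameColumns), and the
--     induced renumbering of columns is a symmetry of a path or cycle
--     (columnSymmetry, from the rigidity lemma fixes-all);
--   * existence: the ambient graphs carry a column map (i , a) ↦ i inherited by G
--     (inheritColumns); connectivity and maximality force a longest chordless path
--     or cycle to meet every column, and its order numbers them (Existence).

open import Defs
open import Data.Bool using (Bool; true; false; if_then_else_; _∧_) renaming (T to True)
open import Data.Bool.Properties using (T-∨; T-∧; T-≡)
open import Data.Empty using (⊥; ⊥-elim)
open import Data.Fin using (Fin; toℕ; fromℕ<; opposite) renaming (zero to fzero; suc to fsuc)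
open import Data.Fin.Permutation using (_⟨$⟩ʳ_; _⟨$⟩ˡ_; inverseˡ; inverseʳ)
open import Data.Fin.Properties using (toℕ-injective; toℕ-fromℕ<; toℕ<n; injective⇒≤; opposite-prop; opposite-involutive; any?) renaming (_≟_ to _≟ᶠ_)
open import Data.Nat using (ℕ; zero; suc; _+_; _∸_; _≡ᵇ_; _≤_; _<_; z≤n; s≤s; s≤s⁻¹; z<s; _<?_; _≤?_)
open import Data.Nat.Properties
open import Data.Nat.Tactic.RingSolver using (solve-∀)
open import Data.Product using (Σ-syntax; _×_; _,_; proj₁; proj₂; map₂)
open import Data.Product.Function.NonDependent.Propositional using (_×-⇔_)
open import Data.Sum using (_⊎_; inj₁; inj₂) renaming (map to ⊎-map)
open import Data.Sum.Function.Propositional using (_⊎-⇔_)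
open import Data.Unit using (tt)
open import Function using (_∘_)
open import Function.Bundles using (_⇔_; mk⇔; Equivalence)
open import Function.Construct.Composition using (_⇔-∘_)
open import Function.Construct.Symmetry using (⇔-sym)
open import Function.Definitions using (Injective)
open import Relation.Binary.Definitions using (tri<; tri≈; tri>)
open import Relation.Binary.PropositionalEquality
open import Relation.Nullary using (¬_; Dec; yes; no; ¬?)
open import Relation.Nullary.Decidable using (_×-dec_)

open Equivalence using (to; from)

-- Adjacency of positions, on natural numbers: LinAdj i j is LinAdjℕ (toℕ i) (toℕ j)
-- and CycAdj r i j is CycAdjℕ r (toℕ i) (toℕ j), definitionally.
LinAdjℕ : ℕ → ℕ → Set
LinAdjℕ a b = (suc a ≡ b) ⊎ (suc b ≡ a)

CycAdjℕ : ℕ → ℕ → ℕ → Set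
CycAdjℕ r a b = LinAdjℕ a b ⊎ ((a ≡ 0) × (suc b ≡ r)) ⊎ ((b ≡ 0) × (suc a ≡ r))

linAdj-irrefl : ∀ {k} (i : Fin k) → ¬ LinAdj i i
linAdj-irrefl i (inj₁ si≡i) = 1+n≢n si≡i
linAdj-irrefl i (inj₂ si≡i) = 1+n≢n si≡i

colAdj-irrefl : ∀ b {k} → 2 ≤ k → (i : Fin k) → ¬ ColAdj b k i i
colAdj-irrefl false _ = linAdj-irrefl
colAdj-irrefl true _ i (inj₁ lin) = linAdj-irrefl i lin
colAdj-irrefl true k≥2 i (inj₂ (inj₁ (i≡0 , si≡k))) = <⇒≢ k≥2 (trans (cong suc (sym i≡0)) si≡k)
colAdj-irrefl true k≥2 i (inj₂ (inj₂ (i≡0 , si≡k))) = <⇒≢ k≥2 (trans (cong suc (sym i≡0)) si≡k)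

linAdj-sym : ∀ {r} {i j : Fin r} → LinAdj i j → LinAdj j i
linAdj-sym (inj₁ si≡j) = inj₂ si≡j
linAdj-sym (inj₂ sj≡i) = inj₁ sj≡i

colAdj-sym : ∀ b {r} {i j : Fin r} → ColAdj b r i j → ColAdj b r j i
colAdj-sym false = linAdj-sym
colAdj-sym true (inj₁ lin) = inj₁ (linAdj-sym lin)
colAdj-sym true (inj₂ (inj₁ wrap)) = inj₂ (inj₂ wrap)
colAdj-sym true (inj₂ (inj₂ wrap)) = inj₂ (inj₁ wrap)

consecutive-adjacent : ∀ b {r} {i j : Fin r} → suc (toℕ i) ≡ toℕ j → ColAdj b r i j
consecutive-adjacent false si≡j = inj₁ si≡j
consecutive-adjacent true si≡j = inj₁ (inj₁ si≡j)

CycSucc : ℕ → ℕ → ℕ → Set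
CycSucc r a b = (suc a ≡ b) ⊎ ((suc a ≡ r) × (b ≡ 0))

cycAdj→succ : ∀ {r a b} → CycAdjℕ r a b → CycSucc r a b ⊎ CycSucc r b a
cycAdj→succ (inj₁ (inj₁ sa≡b)) = inj₁ (inj₁ sa≡b)
cycAdj→succ (inj₁ (inj₂ sb≡a)) = inj₂ (inj₁ sb≡a)
cycAdj→succ (inj₂ (inj₁ (a≡0 , sb≡r))) = inj₂ (inj₂ (sb≡r , a≡0))
cycAdj→succ (inj₂ (inj₂ (b≡0 , sa≡r))) = inj₁ (inj₂ (sa≡r , b≡0))

succ→cycAdj : ∀ {r a b} → CycSucc r a b ⊎ CycSucc r b a → CycAdjℕ r a b
succ→cycAdj (inj₁ (inj₁ sa≡b)) = inj₁ (inj₁ sa≡b)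
succ→cycAdj (inj₂ (inj₁ sb≡a)) = inj₁ (inj₂ sb≡a)
succ→cycAdj (inj₂ (inj₂ (sb≡r , a≡0))) = inj₂ (inj₁ (a≡0 , sb≡r))
succ→cycAdj (inj₁ (inj₂ (sa≡r , b≡0))) = inj₂ (inj₂ (b≡0 , sa≡r))

pigeonhole : ∀ {A : Set} (P Q : A → Set) → (∀ {x y} → P x → P y → x ≡ y) → (∀ {x y} → Q x → Q y → x ≡ y) →
  ∀ {x y z} → P x ⊎ Q x → P y ⊎ Q y → P z ⊎ Q z → (x ≡ y) ⊎ (y ≡ z) ⊎ (x ≡ z)
pigeonhole P Q P-unique Q-unique (inj₁ px) (inj₁ py) _ = inj₁ (P-unique px py)
pigeonhole P Q P-unique Q-unique (inj₂ qx) (inj₂ qy) _ = inj₁ (Q-unique qx qy)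
pigeonhole P Q P-unique Q-unique _ (inj₁ py) (inj₁ pz) = inj₂ (inj₁ (P-unique py pz))
pigeonhole P Q P-unique Q-unique _ (inj₂ qy) (inj₂ qz) = inj₂ (inj₁ (Q-unique qy qz))
pigeonhole P Q P-unique Q-unique (inj₁ px) (inj₂ _) (inj₁ pz) = inj₂ (inj₂ (P-unique px pz))
pigeonhole P Q P-unique Q-unique (inj₂ qx) (inj₁ _) (inj₂ qz) = inj₂ (inj₂ (Q-unique qx qz))

cycSucc-unique : ∀ {r a b b′} → b < r → b′ < r → CycSucc r a b → CycSucc r a b′ → b ≡ b′
cycSucc-unique _ _ (inj₁ sa≡b) (inj₁ sa≡b′) = trans (sym sa≡b) sa≡b′
cycSucc-unique b<r _ (inj₁ sa≡b) (inj₂ (sa≡r , _)) = ⊥-elim (<⇒≢ b<r (trans (sym sa≡b) sa≡r))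
cycSucc-unique _ b′<r (inj₂ (sa≡r , _)) (inj₁ sa≡b′) = ⊥-elim (<⇒≢ b′<r (trans (sym sa≡b′) sa≡r))
cycSucc-unique _ _ (inj₂ (_ , b≡0)) (inj₂ (_ , b′≡0)) = trans b≡0 (sym b′≡0)

cycPred-unique : ∀ {r a a′ b} → CycSucc r a b → CycSucc r a′ b → a ≡ a′
cycPred-unique (inj₁ sa≡b) (inj₁ sa′≡b) = suc-injective (trans sa≡b (sym sa′≡b))
cycPred-unique (inj₁ sa≡b) (inj₂ (_ , b≡0)) = ⊥-elim (1+n≢0 (trans sa≡b b≡0))
cycPred-unique (inj₂ (_ , b≡0)) (inj₁ sa′≡b) = ⊥-elim (1+n≢0 (trans sa′≡b b≡0))
cycPred-unique (inj₂ (sa≡r , _)) (inj₂ (sa′≡r , _)) = suc-injective (trans sa≡r (sym sa′≡r))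

colAdj-degree≤2 : ∀ b {k} {i j j′ j″ : Fin k} →
  ColAdj b k i j → ColAdj b k i j′ → ColAdj b k i j″ → (j ≡ j′) ⊎ (j′ ≡ j″) ⊎ (j ≡ j″)
colAdj-degree≤2 false {i = i} =
  pigeonhole (λ j → suc (toℕ i) ≡ toℕ j) (λ j → suc (toℕ j) ≡ toℕ i)
    (λ si≡j si≡j′ → toℕ-injective (trans (sym si≡j) si≡j′))
    (λ sj≡i sj′≡i → toℕ-injective (suc-injective (trans sj≡i (sym sj′≡i))))
colAdj-degree≤2 true {k} {i} i∼j i∼j′ i∼j″ =
  pigeonhole (λ j → CycSucc k (toℕ i) (toℕ j)) (λ j → CycSucc k (toℕ j) (toℕ i))
    (λ {j} {j′} i→j i→j′ → toℕ-injective (cycSucc-unique (toℕ<n j) (toℕ<n j′) i→j i→j′))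
    (λ j→i j′→i → toℕ-injective (cycPred-unique j→i j′→i))
    (cycAdj→succ i∼j) (cycAdj→succ i∼j′) (cycAdj→succ i∼j″)

Separates : (ℕ → ℕ → Set) → ℕ → ℕ → ℕ → Set
Separates A m a b = (m ≢ a) × (m ≢ b) × ((A a m × ¬ A b m) ⊎ (A b m × ¬ A a m))

separates-sym : ∀ {A m a b} → Separates A m a b → Separates A m b a
separates-sym (m≢a , m≢b , inj₁ only-a) = m≢b , m≢a , inj₂ only-a
separates-sym (m≢a , m≢b , inj₂ only-b) = m≢b , m≢a , inj₁ only-b

pathSeparated : ∀ {r a b} → 4 ≤ r → a < b → b < r →
  Σ[ m ∈ ℕ ] (m < r) × Separates LinAdjℕ m a b
pathSeparated {a = suc p} {b} _ a<b b<r =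
  p , <-trans p<b b<r , <⇒≢ (n<1+n p) , <⇒≢ p<b ,
  inj₁ (inj₂ refl , λ { (inj₁ sb≡p) → <-asym p<b (≤-reflexive sb≡p)
                      ; (inj₂ sp≡b) → <⇒≢ a<b sp≡b })
  where
  p<b : p < b
  p<b = <-trans (n<1+n p) a<b
pathSeparated {r} {zero} {b} r≥4 0<b b<r with suc b <? r
... | yes sb<r = suc b , sb<r , (λ ()) , 1+n≢n ,
  inj₂ (inj₁ refl , λ { (inj₁ 1≡sb) → <⇒≢ 0<b (suc-injective 1≡sb) ; (inj₂ ()) })
... | no sb≮r = 1 , <-trans 1<b b<r , (λ ()) , <⇒≢ 1<b ,
  inj₁ (inj₁ refl , λ { (inj₁ sb≡1) → <⇒≢ 0<b (sym (suc-injective sb≡1))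
                      ; (inj₂ 2≡b) → <⇒≢ b≥3 2≡b })
  where
  b≥3 : 3 ≤ b
  b≥3 = s≤s⁻¹ (subst (4 ≤_) (sym (≤-antisym b<r (≮⇒≥ sb≮r))) r≥4)
  1<b : 1 < b
  1<b = ≤-trans (s≤s (s≤s z≤n)) b≥3

cycleSeparated : ∀ {r a b} → 5 ≤ r → a < b → b < r →
  Σ[ m ∈ ℕ ] (m < r) × Separates (CycAdjℕ r) m a b
cycleSeparated {r} {suc (suc p)} {b} _ a<b b<r =
  suc p , <-trans m<b b<r , <⇒≢ (n<1+n (suc p)) , <⇒≢ m<b ,
  inj₁ (inj₁ (inj₂ refl) , λ { (inj₁ (inj₁ sb≡m)) → <-asym m<b (≤-reflexive sb≡m)
                             ; (inj₁ (inj₂ sm≡b)) → <⇒≢ a<b sm≡b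
                             ; (inj₂ (inj₁ (b≡0 , _))) → <⇒≢ (<-trans z<s a<b) (sym b≡0)
                             ; (inj₂ (inj₂ (() , _))) })
  where
  m<b : suc p < b
  m<b = <-trans (n<1+n (suc p)) a<b
cycleSeparated {r} {1} {b} r≥5 1<b b<r with suc b ≟ r
... | no sb≢r = 0 , <-trans z<s (<-trans 1<b b<r) , (λ ()) , <⇒≢ (<-trans z<s 1<b) ,
  inj₁ (inj₁ (inj₂ refl) , λ { (inj₁ (inj₁ ()))
                             ; (inj₁ (inj₂ 1≡b)) → <⇒≢ 1<b 1≡b
                             ; (inj₂ (inj₁ (b≡0 , _))) → <⇒≢ (<-trans z<s 1<b) (sym b≡0)
                             ; (inj₂ (inj₂ (_ , sb≡r))) → sb≢r sb≡r })
... | yes sb≡r = 2 , <-trans 2<b b<r , (λ ()) , <⇒≢ 2<b ,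
  inj₁ (inj₁ (inj₁ refl) , λ { (inj₁ (inj₁ sb≡2)) → <⇒≢ 1<b (sym (suc-injective sb≡2))
                             ; (inj₁ (inj₂ 3≡b)) → <⇒≢ b≥4 3≡b
                             ; (inj₂ (inj₁ (b≡0 , _))) → <⇒≢ (<-trans z<s 1<b) (sym b≡0)
                             ; (inj₂ (inj₂ (() , _))) })
  where
  b≥4 : 4 ≤ b
  b≥4 = s≤s⁻¹ (subst (5 ≤_) (sym sb≡r) r≥5)
  2<b : 2 < b
  2<b = ≤-trans (s≤s (s≤s (s≤s z≤n))) b≥4
cycleSeparated {r} {zero} {b} r≥5 0<b b<r with 3 ≤? b
... | yes b≥3 = 1 , <-trans 1<b b<r , (λ ()) , <⇒≢ 1<b ,
  inj₁ (inj₁ (inj₁ refl) , λ { (inj₁ (inj₁ sb≡1)) → <⇒≢ 0<b (sym (suc-injective sb≡1))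
                             ; (inj₁ (inj₂ 2≡b)) → <⇒≢ b≥3 2≡b
                             ; (inj₂ (inj₁ (b≡0 , _))) → <⇒≢ 0<b (sym b≡0)
                             ; (inj₂ (inj₂ (() , _))) })
  where
  1<b : 1 < b
  1<b = ≤-trans (s≤s (s≤s z≤n)) b≥3
... | no b≱3 = suc b , <-trans (n<1+n (suc b)) ssb<r , (λ ()) , 1+n≢n ,
  inj₂ (inj₁ (inj₁ refl) , λ { (inj₁ (inj₁ 1≡sb)) → <⇒≢ 0<b (suc-injective 1≡sb)
                             ; (inj₁ (inj₂ ()))
                             ; (inj₂ (inj₁ (_ , ssb≡r))) → <⇒≢ ssb<r ssb≡r
                             ; (inj₂ (inj₂ (() , _))) })
  where
  ssb<r : suc (suc b) < r
  ssb<r = ≤-trans (s≤s (s≤s (≰⇒> b≱3))) r≥5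

SeparatedBy : {r : ℕ} → (Fin r → Fin r → Set) → Fin r → Fin r → Fin r → Set
SeparatedBy A m i j = (m ≢ i) × (m ≢ j) × ((A i m × ¬ A j m) ⊎ (A j m × ¬ A i m))

separatingPosition : ∀ {r} (A : ℕ → ℕ → Set) (i j : Fin r) →
  Σ[ m ∈ ℕ ] (m < r) × Separates A m (toℕ i) (toℕ j) →
  Σ[ m ∈ Fin r ] SeparatedBy (λ p q → A (toℕ p) (toℕ q)) m i j
separatingPosition A i j (m , m<r , sep) with fromℕ< m<r | toℕ-fromℕ< m<r
... | m′ | refl = m′ , proj₁ sep ∘ cong toℕ , proj₁ (proj₂ sep) ∘ cong toℕ , proj₂ (proj₂ sep)

finSeparated : ∀ {r} (A : ℕ → ℕ → Set) →
  (∀ {a b} → a < b → b < r → Σ[ m ∈ ℕ ] (m < r) × Separates A m a b) →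
  ∀ (i j : Fin r) → i ≢ j → Σ[ m ∈ Fin r ] SeparatedBy (λ p q → A (toℕ p) (toℕ q)) m i j
finSeparated A separated i j i≢j with <-cmp (toℕ i) (toℕ j)
... | tri< i<j _ _ = separatingPosition A i j (separated i<j (toℕ<n j))
... | tri≈ _ i≡j _ = ⊥-elim (i≢j (toℕ-injective i≡j))
... | tri> _ _ j<i = separatingPosition A i j (map₂ (map₂ (separates-sym {A})) (separated j<i (toℕ<n i)))

colAdjSeparated : ∀ b {r} → 5 ≤ r → ∀ (i j : Fin r) → i ≢ j →
  Σ[ m ∈ Fin r ] SeparatedBy (ColAdj b r) m i j
colAdjSeparated false r≥5 = finSeparated LinAdjℕ (pathSeparated (≤-trans (n≤1+n 4) r≥5))
colAdjSeparated true {r} r≥5 = finSeparated (CycAdjℕ r) (cycleSeparated r≥5)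

IsChordless : {n : ℕ} → Matrix (Fin n) → Bool → (r : ℕ) → (Fin r → Fin n) → Set
IsChordless G b r v = Injective _≡_ _≡_ v × (∀ i j → Edge G (v i) (v j) ⇔ ColAdj b r i j)

Chordless : {n : ℕ} → Matrix (Fin n) → Bool → ℕ → Set
Chordless {n} G b r = Σ[ v ∈ (Fin r → Fin n) ] IsChordless G b r v

chordlessOf : ∀ {n r} {G : Matrix (Fin n)} → HasChordless G r → Σ[ b ∈ Bool ] Chordless G b r
chordlessOf (inj₁ path) = false , path
chordlessOf (inj₂ (_ , cycle)) = true , cycle

hasChordless : ∀ {n r} {G : Matrix (Fin n)} b → 3 ≤ r → Chordless G b r → HasChordless G r
hasChordless false _ path = inj₁ path
hasChordless true r≥3 cycle = inj₂ (r≥3 , cycle)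

IdentifiesTwins : {n : ℕ} {C : Set} → Matrix (Fin n) → (Fin n → C) → Set
IdentifiesTwins {n} G c = ∀ (x y z : Fin n) → c x ≡ c y → z ≢ x → z ≢ y → Edge G x z → Edge G y z

-- Key fact: along a chordless path or cycle with at least five vertices such a
-- colouring takes distinct values, since any two of its vertices are told apart
-- by a third vertex adjacent to exactly one of them.
twins-injective : ∀ {n r b} {C : Set} {G : Matrix (Fin n)} {c : Fin n → C} {v : Fin r → Fin n} →
  IdentifiesTwins G c → 5 ≤ r → IsChordless G b r v → Injective _≡_ _≡_ (c ∘ v)
twins-injective {b = b} {v = v} twins r≥5 (v-inj , v-edges) {i} {j} ci≡cj with i ≟ᶠ j
... | yes i≡j = i≡j
... | no i≢j with colAdjSeparated b r≥5 i j i≢j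
...   | m , m≢i , m≢j , inj₁ (i∼m , j≁m) =
  ⊥-elim (j≁m (to (v-edges j m) (twins (v i) (v j) (v m) ci≡cj (m≢i ∘ v-inj) (m≢j ∘ v-inj) (from (v-edges i m) i∼m))))
...   | m , m≢i , m≢j , inj₂ (j∼m , i≁m) =
  ⊥-elim (i≁m (to (v-edges i m) (twins (v j) (v i) (v m) (sym ci≡cj) (m≢j ∘ v-inj) (m≢i ∘ v-inj) (from (v-edges j m) j∼m))))

-- A column map of G onto a path (b = false) or cycle (b = true) of k columns:
-- the conditions on a profile, except that columns may be empty.
record ColumnMap {n : ℕ} (G : Matrix (Fin n)) (b : Bool) (k : ℕ) : Set where
  field
    column        : Fin n → Fin k
    atMostTwoEach : ∀ x y z → column x ≡ column y → column y ≡ column z → (x ≡ y) ⊎ (y ≡ z) ⊎ (x ≡ z)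
    sameCharge    : ∀ x y → column x ≡ column y → charge G x ≡ charge G y
    edgesBetween  : ∀ x y → x ≢ y →
                      Edge G x y ⇔ (ColAdj b k (column x) (column y) ⊎ ((column x ≡ column y) × (charge G x ≢ zer)))

open ColumnMap

columnsOf : ∀ {n k} {G : Matrix (Fin n)} (P : Profile G k) → ColumnMap G (cycling P) k
columnsOf P = record { column = col P ; atMostTwoEach = atMostTwo P ; sameCharge = uniform P ; edgesBetween = edges P }

module _ {n k b} {G : Matrix (Fin n)} (M : ColumnMap G b k) where

  columns-edgeAcross : ∀ x y → column M x ≢ column M y → Edge G x y ⇔ ColAdj b k (column M x) (column M y)
  columns-edgeAcross x y cx≢cy = mk⇔ (acrossOnly ∘ to (edgesBetween M x y x≢y)) (from (edgesBetween M x y x≢y) ∘ inj₁)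
    where
    x≢y : x ≢ y
    x≢y = cx≢cy ∘ cong (column M)
    acrossOnly : ColAdj b k (column M x) (column M y) ⊎ ((column M x ≡ column M y) × (charge G x ≢ zer)) →
      ColAdj b k (column M x) (column M y)
    acrossOnly (inj₁ adjacent) = adjacent
    acrossOnly (inj₂ (same , _)) = ⊥-elim (cx≢cy same)

  columns-twins : IdentifiesTwins G (column M)
  columns-twins x y z cx≡cy z≢x z≢y x∼z =
    from (edgesBetween M y z (z≢y ∘ sym)) (moveToY (to (edgesBetween M x z (z≢x ∘ sym)) x∼z))
    where
    moveToY : ColAdj b k (column M x) (column M z) ⊎ ((column M x ≡ column M z) × (charge G x ≢ zer)) →
      ColAdj b k (column M y) (column M z) ⊎ ((column M y ≡ column M z) × (charge G y ≢ zer))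
    moveToY (inj₁ adjacent) = inj₁ (subst (λ c → ColAdj b k c (column M z)) cx≡cy adjacent)
    moveToY (inj₂ (same , charged)) = inj₂ (trans (sym cx≡cy) same , subst (_≢ zer) (sameCharge M x y cx≡cy) charged)

  representatives-chordless : 2 ≤ k → (v : Fin k → Fin n) → (∀ i → column M (v i) ≡ i) → IsChordless G b k v
  representatives-chordless k≥2 v cv = v-inj , v-edges
    where
    v-inj : Injective _≡_ _≡_ v
    v-inj {i} {j} vi≡vj = trans (sym (cv i)) (trans (cong (column M) vi≡vj) (cv j))
    v-edges : ∀ i j → Edge G (v i) (v j) ⇔ ColAdj b k i j
    v-edges i j with i ≟ᶠ j
    ... | yes refl = mk⇔ (λ loop → ⊥-elim (proj₁ loop refl)) (⊥-elim ∘ colAdj-irrefl b k≥2 i)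
    ... | no i≢j = subst₂ (λ p q → Edge G (v i) (v j) ⇔ ColAdj b k p q) (cv i) (cv j)
                     (columns-edgeAcross (v i) (v j) (λ e → i≢j (trans (sym (cv i)) (trans e (cv j)))))

profile-2≤k : ∀ {n k} {G : Matrix (Fin n)} (P : Profile G k) → 2 ≤ k
profile-2≤k P = ≤-trans (n≤1+n 2) (three≤k P)

representatives : ∀ {n k} {G : Matrix (Fin n)} (P : Profile G k) → Chordless G (cycling P) k
representatives P = (λ i → proj₁ (nonempty P i)) ,
  representatives-chordless (columnsOf P) (profile-2≤k P) _ (λ i → proj₂ (nonempty P i))

-- The number of columns of any profile is the path rank: representatives give a
-- chordless path or cycle with k vertices, and a longest chordless path or cycle
-- meets every column at most once.
profileRank≡pathRank : ∀ {n r k} {G : Matrix (Fin n)} → PathRank G r → 5 ≤ r → Profile G k → k ≡ r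
profileRank≡pathRank {G = G} (longest , maximal) r≥5 P =
  ≤-antisym (maximal _ (hasChordless {G = G} (cycling P) (three≤k P) (representatives P)))
            (injective⇒≤ (twins-injective {G = G} (columns-twins (columnsOf P)) r≥5 (proj₂ (proj₂ (chordlessOf {G = G} longest)))))

neighbourValues : ∀ b {r} {x y : Fin r} {q} → ColAdj b r x y → toℕ x ≡ suc q →
  (toℕ y ≡ suc (suc q)) ⊎ (toℕ y ≡ q) ⊎ (toℕ y ≡ 0)
neighbourValues false (inj₁ sx≡y) x≡sq = inj₁ (trans (sym sx≡y) (cong suc x≡sq))
neighbourValues false (inj₂ sy≡x) x≡sq = inj₂ (inj₁ (suc-injective (trans sy≡x x≡sq)))
neighbourValues true (inj₁ lin) x≡sq = neighbourValues false lin x≡sq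
neighbourValues true (inj₂ (inj₁ (x≡0 , _))) x≡sq = ⊥-elim (1+n≢0 (trans (sym x≡sq) x≡0))
neighbourValues true (inj₂ (inj₂ (y≡0 , _))) _ = inj₂ (inj₂ y≡0)

-- Position a + 2 is a neighbour of a + 1, so it is sent to a neighbour of a + 1
-- other than the images of a and 0, which leaves only a + 2.
fixes-all : ∀ b {r} (h : Fin r → Fin r) → Injective _≡_ _≡_ h →
  (∀ i j → ColAdj b r i j → ColAdj b r (h i) (h j)) →
  (∀ i → toℕ i ≡ 0 → toℕ (h i) ≡ 0) → (∀ i → toℕ i ≡ 1 → toℕ (h i) ≡ 1) →
  ∀ i → toℕ (h i) ≡ toℕ i
fixes-all b {r} h h-inj preserves fix0 fix1 i = fixed (toℕ i) i refl
  where
  collide : ∀ {a} (i j : Fin r) → toℕ j ≡ a → toℕ (h j) ≡ a → toℕ (h i) ≡ a → toℕ i ≡ a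
  collide i j j≡a hj≡a hi≡a = trans (cong toℕ (h-inj (toℕ-injective (trans hi≡a (sym hj≡a))))) j≡a

  fixed : ∀ a (i : Fin r) → toℕ i ≡ a → toℕ (h i) ≡ a
  fixed zero = fix0
  fixed (suc zero) = fix1
  fixed (suc (suc q)) i i≡a = atSuccessor (neighbourValues b (preserves p i p∼i) (fixed (suc q) p p≡sq))
    where
    sq<r : suc q < r
    sq<r = <-trans (n<1+n (suc q)) (subst (_< r) i≡a (toℕ<n i))
    p p′ z : Fin r
    p = fromℕ< sq<r
    p′ = fromℕ< (<-trans (n<1+n q) sq<r)
    z = fromℕ< (<-trans z<s sq<r)
    p≡sq : toℕ p ≡ suc q
    p≡sq = toℕ-fromℕ< sq<r
    p∼i : ColAdj b r p i
    p∼i = consecutive-adjacent b (trans (cong suc p≡sq) (sym i≡a))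
    atSuccessor : (toℕ (h i) ≡ suc (suc q)) ⊎ (toℕ (h i) ≡ q) ⊎ (toℕ (h i) ≡ 0) → toℕ (h i) ≡ suc (suc q)
    atSuccessor (inj₁ hi≡a) = hi≡a
    atSuccessor (inj₂ (inj₁ hi≡q)) =
      ⊥-elim (<⇒≢ (<-trans (n<1+n q) (n<1+n (suc q)))
               (trans (sym (collide i p′ (toℕ-fromℕ< _) (fixed q p′ (toℕ-fromℕ< _)) hi≡q)) i≡a))
    atSuccessor (inj₂ (inj₂ hi≡0)) =
      ⊥-elim (1+n≢0 (trans (sym i≡a) (collide i z (toℕ-fromℕ< _) (fix0 z (toℕ-fromℕ< _)) hi≡0)))

fixedValue : ∀ {r} (k : Fin r → Fin r) {a} (p : Fin r) → toℕ p ≡ a → toℕ (k p) ≡ a → ∀ i → toℕ i ≡ a → toℕ (k i) ≡ a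
fixedValue k p p≡a kp≡a i i≡a = trans (cong (toℕ ∘ k) (toℕ-injective (trans i≡a (sym p≡a)))) kp≡a

innerNeighbours : ∀ b {r} (x : Fin r) {a} → toℕ x ≡ suc a → suc (suc a) < r →
  Σ[ p ∈ Fin r ] Σ[ q ∈ Fin r ] ColAdj b r x p × ColAdj b r x q × (p ≢ q)
innerNeighbours b {r} x {a} x≡sa ssa<r =
  p , q , colAdj-sym b (consecutive-adjacent b (trans (cong suc p≡a) (sym x≡sa))) ,
  consecutive-adjacent b (trans (cong suc x≡sa) (sym q≡ssa)) ,
  λ p≡q → <⇒≢ (<-trans (n<1+n a) (n<1+n (suc a))) (trans (sym p≡a) (trans (cong toℕ p≡q) q≡ssa))
  where
  a<r : a < r
  a<r = <-trans (<-trans (n<1+n a) (n<1+n (suc a))) ssa<r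
  p q : Fin r
  p = fromℕ< a<r
  q = fromℕ< ssa<r
  p≡a : toℕ p ≡ a
  p≡a = toℕ-fromℕ< a<r
  q≡ssa : toℕ q ≡ suc (suc a)
  q≡ssa = toℕ-fromℕ< ssa<r

cycleNeighbours : ∀ {r} → 3 ≤ r → (x : Fin r) →
  Σ[ p ∈ Fin r ] Σ[ q ∈ Fin r ] CycAdj r x p × CycAdj r x q × (p ≢ q)
cycleNeighbours {suc r′} (s≤s r′≥2) x = byValue (toℕ x) refl
  where
  byValue : ∀ a → toℕ x ≡ a →
    Σ[ p ∈ Fin (suc r′) ] Σ[ q ∈ Fin (suc r′) ] CycAdj (suc r′) x p × CycAdj (suc r′) x q × (p ≢ q)
  byValue zero x≡0 =
    fromℕ< 1<r , fromℕ< (n<1+n r′) ,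
    inj₁ (inj₁ (trans (cong suc x≡0) (sym (toℕ-fromℕ< 1<r)))) ,
    inj₂ (inj₁ (x≡0 , cong suc (toℕ-fromℕ< (n<1+n r′)))) ,
    λ one≡last → <⇒≢ r′≥2 (trans (sym (toℕ-fromℕ< 1<r)) (trans (cong toℕ one≡last) (toℕ-fromℕ< (n<1+n r′))))
    where
    1<r : 1 < suc r′
    1<r = s≤s (≤-trans (s≤s z≤n) r′≥2)
  byValue (suc a) x≡sa with suc (suc a) <? suc r′
  ... | yes ssa<r = innerNeighbours true x x≡sa ssa<r
  ... | no ssa≮r =
    p , z , colAdj-sym true (consecutive-adjacent true (trans (cong suc p≡a) (sym x≡sa))) ,
    inj₂ (inj₂ (z≡0 , trans (cong suc x≡sa) ssa≡r)) ,
    λ p≡z → <⇒≢ 0<a (sym (trans (sym p≡a) (trans (cong toℕ p≡z) z≡0)))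
    where
    ssa≡r : suc (suc a) ≡ suc r′
    ssa≡r = ≤-antisym (subst (_< suc r′) x≡sa (toℕ<n x)) (≮⇒≥ ssa≮r)
    0<a : 0 < a
    0<a = s≤s⁻¹ (s≤s⁻¹ (subst (3 ≤_) (sym ssa≡r) (s≤s r′≥2)))
    a<r : a < suc r′
    a<r = <-trans (n<1+n a) (subst (_< suc r′) x≡sa (toℕ<n x))
    p z : Fin (suc r′)
    p = fromℕ< a<r
    z = fromℕ< (z<s {r′})
    p≡a : toℕ p ≡ a
    p≡a = toℕ-fromℕ< a<r
    z≡0 : toℕ z ≡ 0
    z≡0 = toℕ-fromℕ< (z<s {r′})

endNeighbour : ∀ {r} {z m : Fin r} → toℕ z ≡ 0 → LinAdj z m → toℕ m ≡ 1
endNeighbour z≡0 (inj₁ sz≡m) = trans (sym sz≡m) (cong suc z≡0)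
endNeighbour z≡0 (inj₂ sm≡z) = ⊥-elim (1+n≢0 (trans sm≡z z≡0))

endpointImage : ∀ {r} (A : Fin r → Fin r → Set) (f g : Fin r → Fin r) → (∀ j → f (g j) ≡ j) →
  (∀ i j → LinAdj i j ⇔ A (f i) (f j)) →
  ∀ {z p q} → toℕ z ≡ 0 → A (f z) p → A (f z) q → p ≡ q
endpointImage A f g fg adj {z} {p} {q} z≡0 fz∼p fz∼q =
  trans (sym (fg p)) (trans (cong f (toℕ-injective (trans (valueOne p fz∼p) (sym (valueOne q fz∼q))))) (fg q))
  where
  valueOne : ∀ m → A (f z) m → toℕ (g m) ≡ 1
  valueOne m fz∼m = endNeighbour z≡0 (from (adj z (g m)) (subst (A (f z)) (sym (fg m)) fz∼m))

-- No bijection carries path adjacency to cycle adjacency: every position of a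
-- cycle has two neighbours, the end of a path only one.
path≢cycle : ∀ {r} → 3 ≤ r → (f g : Fin r → Fin r) → (∀ j → f (g j) ≡ j) →
  ¬ (∀ i j → LinAdj i j ⇔ CycAdj r (f i) (f j))
path≢cycle {r} r≥3 f g fg adj with cycleNeighbours r≥3 (f (fromℕ< 0<r))
  where
  0<r : 0 < r
  0<r = ≤-trans (s≤s z≤n) r≥3
... | p , q , fz∼p , fz∼q , p≢q = p≢q (endpointImage (CycAdj r) f g fg adj (toℕ-fromℕ< _) fz∼p fz∼q)

opposite-sum : ∀ {r} (x : Fin r) → toℕ (opposite x) + suc (toℕ x) ≡ r
opposite-sum x = trans (cong (_+ suc (toℕ x)) (opposite-prop x)) (m∸n+n≡m (toℕ<n x))

opposite-injective : ∀ {r} → Injective _≡_ _≡_ (opposite {r})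
opposite-injective {x = x} {y} e = trans (sym (opposite-involutive x)) (trans (cong opposite e) (opposite-involutive y))

opposite-successor : ∀ {r} (x y : Fin r) → suc (toℕ x) ≡ toℕ y → suc (toℕ (opposite y)) ≡ toℕ (opposite x)
opposite-successor {r} x y sx≡y = +-cancelʳ-≡ (suc (toℕ x)) _ _ (begin
  suc (toℕ (opposite y)) + suc (toℕ x)  ≡⟨ sym (+-suc (toℕ (opposite y)) (suc (toℕ x))) ⟩
  toℕ (opposite y) + suc (suc (toℕ x))  ≡⟨ cong (λ t → toℕ (opposite y) + suc t) sx≡y ⟩
  toℕ (opposite y) + suc (toℕ y)        ≡⟨ opposite-sum y ⟩
  r                                     ≡⟨ sym (opposite-sum x) ⟩
  toℕ (opposite x) + suc (toℕ x)        ∎)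
  where open ≡-Reasoning

opposite-linAdj : ∀ {r} {x y : Fin r} → LinAdj x y → LinAdj (opposite x) (opposite y)
opposite-linAdj {x = x} {y} (inj₁ sx≡y) = inj₂ (opposite-successor x y sx≡y)
opposite-linAdj {x = x} {y} (inj₂ sy≡x) = inj₁ (opposite-successor y x sy≡x)

pathFixes-all : ∀ {r} (h : Fin r → Fin r) → Injective _≡_ _≡_ h →
  (∀ i j → LinAdj i j → LinAdj (h i) (h j)) →
  (∀ i → toℕ i ≡ 0 → toℕ (h i) ≡ 0) → ∀ i → toℕ (h i) ≡ toℕ i
pathFixes-all {r} h h-inj preserves fix0 = fixes-all false h h-inj preserves fix0 fix1
  where
  fix1 : ∀ i → toℕ i ≡ 1 → toℕ (h i) ≡ 1
  fix1 i i≡1 = endNeighbour (fix0 z z≡0) (preserves z i (inj₁ (trans (cong suc z≡0) (sym i≡1))))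
    where
    0<r : 0 < r
    0<r = <-trans z<s (subst (_< r) i≡1 (toℕ<n i))
    z : Fin r
    z = fromℕ< 0<r
    z≡0 : toℕ z ≡ 0
    z≡0 = toℕ-fromℕ< 0<r

reversedPosition : ∀ {r} (x i : Fin r) → toℕ (opposite x) ≡ toℕ i → toℕ x + toℕ i + 1 ≡ r
reversedPosition {r} x i ox≡i = begin
  toℕ x + toℕ i + 1          ≡⟨ +-comm (toℕ x + toℕ i) 1 ⟩
  suc (toℕ x + toℕ i)        ≡⟨ cong suc (+-comm (toℕ x) (toℕ i)) ⟩
  suc (toℕ i + toℕ x)        ≡⟨ sym (+-suc (toℕ i) (toℕ x)) ⟩
  toℕ i + suc (toℕ x)        ≡⟨ cong (_+ suc (toℕ x)) (sym ox≡i) ⟩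
  toℕ (opposite x) + suc (toℕ x) ≡⟨ opposite-sum x ⟩
  r                          ∎
  where open ≡-Reasoning

inverse-injective : ∀ {r} {f g : Fin r → Fin r} → (∀ i → g (f i) ≡ i) → Injective _≡_ _≡_ f
inverse-injective {f = f} {g} gf {x} {y} fx≡fy = trans (sym (gf x)) (trans (cong g fx≡fy) (gf y))

pathSymmetry : ∀ {r} → 0 < r → (f g : Fin r → Fin r) → (∀ j → f (g j) ≡ j) → (∀ i → g (f i) ≡ i) →
  (∀ i j → LinAdj i j ⇔ LinAdj (f i) (f j)) → Reorder false r f
pathSymmetry {r} 0<r f g fg gf adj = byEndImage (toℕ (f z)) refl
  where
  z : Fin r
  z = fromℕ< 0<r
  z≡0 : toℕ z ≡ 0
  z≡0 = toℕ-fromℕ< 0<r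
  preserves : ∀ i j → LinAdj i j → LinAdj (f i) (f j)
  preserves i j = to (adj i j)
  byEndImage : ∀ a → toℕ (f z) ≡ a → Reorder false r f
  byEndImage zero fz≡0 =
    inj₁ (λ i → toℕ-injective (pathFixes-all f (inverse-injective {g = g} gf) preserves (fixedValue f z z≡0 fz≡0) i))
  byEndImage (suc a) fz≡sa with suc (suc a) ≟ r
  ... | no ssa≢r with innerNeighbours false (f z) fz≡sa (≤∧≢⇒< (subst (_< r) fz≡sa (toℕ<n (f z))) ssa≢r)
  ...   | p , q , fz∼p , fz∼q , p≢q = ⊥-elim (p≢q (endpointImage LinAdj f g fg adj z≡0 fz∼p fz∼q))
  byEndImage (suc a) fz≡sa | yes ssa≡r = inj₂ (inj₁ reversed)
    where
    h : Fin r → Fin r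
    h = opposite ∘ f
    hz≡0 : toℕ (h z) ≡ 0
    hz≡0 = +-cancelʳ-≡ (suc (suc a)) _ 0 (begin
      toℕ (h z) + suc (suc a)      ≡⟨ cong (λ t → toℕ (h z) + suc t) (sym fz≡sa) ⟩
      toℕ (h z) + suc (toℕ (f z))  ≡⟨ opposite-sum (f z) ⟩
      r                            ≡⟨ sym ssa≡r ⟩
      suc (suc a)                  ∎)
      where open ≡-Reasoning
    h≡id : ∀ i → toℕ (h i) ≡ toℕ i
    h≡id = pathFixes-all h (inverse-injective {g = g} gf ∘ opposite-injective) (λ i j → opposite-linAdj ∘ preserves i j) (fixedValue h z z≡0 hz≡0)
    reversed : ∀ i → toℕ (f i) + toℕ i + 1 ≡ r
    reversed i = reversedPosition (f i) i (h≡id i)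

-- A ≡ a − c modulo r (for a, c < r).
Rotated : ℕ → ℕ → ℕ → ℕ → Set
Rotated r c a A = (c ≤ a × A + c ≡ a) ⊎ (a < c × A + c ≡ a + r)

rotated-succ : ∀ {r c a b A B} → c < r → Rotated r c a A → Rotated r c b B → CycSucc r a b → CycSucc r A B
rotated-succ {c = c} _ (inj₁ (_ , A+c≡a)) (inj₁ (_ , B+c≡b)) (inj₁ sa≡b) =
  inj₁ (+-cancelʳ-≡ c _ _ (trans (cong suc A+c≡a) (trans sa≡b (sym B+c≡b))))
rotated-succ _ (inj₁ (c≤a , _)) (inj₂ (b<c , _)) (inj₁ sa≡b) =
  ⊥-elim (<⇒≱ b<c (≤-trans c≤a (≤-trans (n≤1+n _) (≤-reflexive sa≡b))))
rotated-succ {r} {c} {a} {b} {A} {B} _ (inj₂ (a<c , A+c≡a+r)) (inj₁ (c≤b , B+c≡b)) (inj₁ sa≡b) =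
  inj₂ (+-cancelʳ-≡ c (suc A) r (begin
    suc (A + c)  ≡⟨ cong suc A+c≡a+r ⟩
    suc a + r    ≡⟨ cong (_+ r) (trans sa≡b (sym c≡b)) ⟩
    c + r        ≡⟨ +-comm c r ⟩
    r + c        ∎) , +-cancelʳ-≡ c B 0 (trans B+c≡b (sym c≡b)))
  where
  open ≡-Reasoning
  c≡b : c ≡ b
  c≡b = ≤-antisym c≤b (subst (_≤ c) sa≡b a<c)
rotated-succ {r} {c} _ (inj₂ (_ , A+c≡a+r)) (inj₂ (_ , B+c≡b+r)) (inj₁ sa≡b) =
  inj₁ (+-cancelʳ-≡ c _ _ (trans (cong suc A+c≡a+r) (trans (cong (_+ r) sa≡b) (sym B+c≡b+r))))
rotated-succ {r} {c} _ (inj₁ (_ , A+c≡a)) (inj₂ (_ , B+c≡b+r)) (inj₂ (sa≡r , b≡0)) =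
  inj₁ (+-cancelʳ-≡ c _ _ (trans (cong suc A+c≡a) (trans sa≡r (trans (cong (_+ r) (sym b≡0)) (sym B+c≡b+r)))))
rotated-succ c<r (inj₂ (a<c , _)) (inj₂ _) (inj₂ (sa≡r , _)) =
  ⊥-elim (<⇒≱ a<c (s≤s⁻¹ (subst (_ <_) (sym sa≡r) c<r)))
rotated-succ {c = c} {A = A} {B} _ (inj₁ (_ , A+c≡a)) (inj₁ (c≤b , B+c≡b)) (inj₂ (sa≡r , b≡0)) =
  inj₂ (trans (cong suc A≡a) sa≡r , m+n≡0⇒m≡0 B (trans B+c≡b b≡0))
  where
  A≡a : A ≡ _
  A≡a = trans (sym (+-identityʳ A)) (trans (cong (A +_) (sym (n≤0⇒n≡0 (subst (c ≤_) b≡0 c≤b)))) A+c≡a)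
rotated-succ _ (inj₂ (a<c , _)) (inj₁ (c≤b , _)) (inj₂ (_ , b≡0)) =
  ⊥-elim (<⇒≱ a<c (≤-trans (subst (_ ≤_) b≡0 c≤b) z≤n))

rotation : ∀ {r} c → c < r → (x : Fin r) → Σ[ y ∈ Fin r ] Rotated r c (toℕ x) (toℕ y)
rotation {r} c c<r x with c ≤? toℕ x
... | yes c≤x = fromℕ< x∸c<r , inj₁ (c≤x , trans (cong (_+ c) (toℕ-fromℕ< x∸c<r)) (m∸n+n≡m c≤x))
  where
  x∸c<r : toℕ x ∸ c < r
  x∸c<r = ≤-<-trans (m∸n≤m (toℕ x) c) (toℕ<n x)
... | no c≰x = fromℕ< x+r∸c<r , inj₂ (x<c , trans (cong (_+ c) (toℕ-fromℕ< x+r∸c<r)) (m∸n+n≡m c≤x+r))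
  where
  x<c : toℕ x < c
  x<c = ≰⇒> c≰x
  c≤x+r : c ≤ toℕ x + r
  c≤x+r = ≤-trans (<⇒≤ c<r) (m≤n+m r (toℕ x))
  x+r∸c<r : toℕ x + r ∸ c < r
  x+r∸c<r = subst (toℕ x + r ∸ c <_) (m+n∸m≡n c r) (∸-monoˡ-< (+-monoˡ-< r x<c) c≤x+r)

rotated-injective : ∀ {r c a b A} → a < r → b < r → Rotated r c a A → Rotated r c b A → a ≡ b
rotated-injective _ _ (inj₁ (_ , A+c≡a)) (inj₁ (_ , A+c≡b)) = trans (sym A+c≡a) A+c≡b
rotated-injective {r} a<r _ (inj₁ (_ , A+c≡a)) (inj₂ (_ , A+c≡b+r)) =
  ⊥-elim (<⇒≱ a<r (subst (r ≤_) (trans (sym A+c≡b+r) A+c≡a) (m≤n+m r _)))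
rotated-injective {r} _ b<r (inj₂ (_ , A+c≡a+r)) (inj₁ (_ , A+c≡b)) =
  ⊥-elim (<⇒≱ b<r (subst (r ≤_) (trans (sym A+c≡a+r) A+c≡b) (m≤n+m r _)))
rotated-injective {r} _ _ (inj₂ (_ , A+c≡a+r)) (inj₂ (_ , A+c≡b+r)) = +-cancelʳ-≡ r _ _ (trans (sym A+c≡a+r) A+c≡b+r)

rotate : ∀ {r} c → c < r → Fin r → Fin r
rotate c c<r x = proj₁ (rotation c c<r x)

rotate-injective : ∀ {r} c (c<r : c < r) → Injective _≡_ _≡_ (rotate c c<r)
rotate-injective c c<r {x} {y} e = toℕ-injective (rotated-injective (toℕ<n x) (toℕ<n y)
  (proj₂ (rotation c c<r x)) (subst (Rotated _ c (toℕ y) ∘ toℕ) (sym e) (proj₂ (rotation c c<r y))))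

rotate-cycAdj : ∀ {r} c (c<r : c < r) {x y : Fin r} → CycAdj r x y → CycAdj r (rotate c c<r x) (rotate c c<r y)
rotate-cycAdj c c<r {x} {y} x∼y with cycAdj→succ x∼y
... | inj₁ x→y = succ→cycAdj (inj₁ (rotated-succ c<r (proj₂ (rotation c c<r x)) (proj₂ (rotation c c<r y)) x→y))
... | inj₂ y→x = succ→cycAdj (inj₂ (rotated-succ c<r (proj₂ (rotation c c<r y)) (proj₂ (rotation c c<r x)) y→x))

-- A ≡ − a modulo r.
Reflected : ℕ → ℕ → ℕ → Set
Reflected r a A = (a ≡ 0 × A ≡ 0) ⊎ (a ≢ 0 × A + a ≡ r)

reflected-succ : ∀ {r a b A B} → 2 ≤ r → Reflected r a A → Reflected r b B → CycSucc r a b → CycSucc r B A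
reflected-succ _ _ (inj₁ (b≡0 , _)) (inj₁ sa≡b) = ⊥-elim (1+n≢0 (trans sa≡b b≡0))
reflected-succ {B = B} _ (inj₁ (a≡0 , A≡0)) (inj₂ (_ , B+b≡r)) (inj₁ sa≡b) =
  inj₂ (trans (+-comm 1 B) (trans (cong (B +_) (trans (cong suc (sym a≡0)) sa≡b)) B+b≡r) , A≡0)
reflected-succ {a = a} {B = B} _ (inj₂ (_ , A+a≡r)) (inj₂ (_ , B+b≡r)) (inj₁ sa≡b) =
  inj₁ (+-cancelʳ-≡ a _ _ (trans (sym (+-suc B a)) (trans (cong (B +_) sa≡b) (trans B+b≡r (sym A+a≡r)))))
reflected-succ _ _ (inj₂ (b≢0 , _)) (inj₂ (_ , b≡0)) = ⊥-elim (b≢0 b≡0)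
reflected-succ r≥2 (inj₁ (a≡0 , _)) (inj₁ _) (inj₂ (sa≡r , _)) =
  ⊥-elim (<⇒≱ (subst (_< 2) (trans (sym (cong suc a≡0)) sa≡r) ≤-refl) r≥2)
reflected-succ {a = a} _ (inj₂ (_ , A+a≡r)) (inj₁ (_ , B≡0)) (inj₂ (sa≡r , _)) =
  inj₁ (trans (cong suc B≡0) (sym (+-cancelʳ-≡ a _ 1 (trans A+a≡r (sym sa≡r)))))

reflected-injective : ∀ {r a b A} → a < r → b < r → Reflected r a A → Reflected r b A → a ≡ b
reflected-injective _ _ (inj₁ (a≡0 , _)) (inj₁ (b≡0 , _)) = trans a≡0 (sym b≡0)
reflected-injective _ b<r (inj₁ (_ , A≡0)) (inj₂ (_ , A+b≡r)) = ⊥-elim (<⇒≢ b<r (trans (cong (_+ _) (sym A≡0)) A+b≡r))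
reflected-injective a<r _ (inj₂ (_ , A+a≡r)) (inj₁ (_ , A≡0)) = ⊥-elim (<⇒≢ a<r (trans (cong (_+ _) (sym A≡0)) A+a≡r))
reflected-injective {A = A} _ _ (inj₂ (_ , A+a≡r)) (inj₂ (_ , A+b≡r)) = +-cancelˡ-≡ A _ _ (trans A+a≡r (sym A+b≡r))

reflection : ∀ {r} (x : Fin r) → Σ[ y ∈ Fin r ] Reflected r (toℕ x) (toℕ y)
reflection {r} x with toℕ x ≟ 0
... | yes x≡0 = x , inj₁ (x≡0 , x≡0)
... | no x≢0 = fromℕ< r∸x<r , inj₂ (x≢0 , trans (cong (_+ toℕ x) (toℕ-fromℕ< r∸x<r)) (m∸n+n≡m (<⇒≤ (toℕ<n x))))
  where
  r∸x<r : r ∸ toℕ x < r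
  r∸x<r = ∸-monoʳ-< (n≢0⇒n>0 x≢0) (<⇒≤ (toℕ<n x))

reflect : ∀ {r} → Fin r → Fin r
reflect x = proj₁ (reflection x)

reflect-injective : ∀ {r} → Injective _≡_ _≡_ (reflect {r})
reflect-injective {r} {x} {y} e = toℕ-injective (reflected-injective (toℕ<n x) (toℕ<n y)
  (proj₂ (reflection x)) (subst (Reflected r (toℕ y) ∘ toℕ) (sym e) (proj₂ (reflection y))))

reflect-cycAdj : ∀ {r} → 2 ≤ r → {x y : Fin r} → CycAdj r x y → CycAdj r (reflect x) (reflect y)
reflect-cycAdj r≥2 {x} {y} x∼y with cycAdj→succ x∼y
... | inj₁ x→y = succ→cycAdj (inj₂ (reflected-succ r≥2 (proj₂ (reflection x)) (proj₂ (reflection y)) x→y))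
... | inj₂ y→x = succ→cycAdj (inj₁ (reflected-succ r≥2 (proj₂ (reflection y)) (proj₂ (reflection x)) y→x))

zeroNeighbours : ∀ {r} {x y : Fin r} → CycAdj r x y → toℕ x ≡ 0 → (toℕ y ≡ 1) ⊎ (suc (toℕ y) ≡ r)
zeroNeighbours (inj₁ (inj₁ sx≡y)) x≡0 = inj₁ (trans (sym sx≡y) (cong suc x≡0))
zeroNeighbours (inj₁ (inj₂ sy≡x)) x≡0 = ⊥-elim (1+n≢0 (trans sy≡x x≡0))
zeroNeighbours (inj₂ (inj₁ (_ , sy≡r))) _ = inj₂ sy≡r
zeroNeighbours (inj₂ (inj₂ (y≡0 , sx≡r))) x≡0 = inj₂ (trans (cong suc (trans y≡0 (sym x≡0))) sx≡r)

rotated-reflected : ∀ {r c F y i} → c < r → Rotated r c F y → Reflected r y i → (F + i ≡ c) ⊎ (F + i ≡ c + r)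
rotated-reflected {c = c} {F} _ (inj₁ (_ , y+c≡F)) (inj₁ (y≡0 , i≡0)) =
  inj₁ (trans (cong (F +_) i≡0) (trans (+-identityʳ F) (trans (sym y+c≡F) (cong (_+ c) y≡0))))
rotated-reflected {r} c<r (inj₂ (_ , y+c≡F+r)) (inj₁ (y≡0 , _)) =
  ⊥-elim (<⇒≱ c<r (subst (r ≤_) (trans (sym y+c≡F+r) (cong (_+ _) y≡0)) (m≤n+m r _)))
rotated-reflected {r} {c} {F} {y} {i} _ (inj₁ (_ , y+c≡F)) (inj₂ (_ , i+y≡r)) = inj₂ (begin
  F + i        ≡⟨ cong (_+ i) (sym y+c≡F) ⟩
  y + c + i    ≡⟨ regroup y c i ⟩
  i + y + c    ≡⟨ cong (_+ c) i+y≡r ⟩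
  r + c        ≡⟨ +-comm r c ⟩
  c + r        ∎)
  where
  open ≡-Reasoning
  regroup : ∀ y c i → y + c + i ≡ i + y + c
  regroup = solve-∀
rotated-reflected {r} {c} {F} {y} {i} _ (inj₂ (_ , y+c≡F+r)) (inj₂ (_ , i+y≡r)) = inj₁ (+-cancelʳ-≡ r _ _ (begin
  F + i + r    ≡⟨ regroup F i r ⟩
  F + r + i    ≡⟨ cong (_+ i) (sym y+c≡F+r) ⟩
  y + c + i    ≡⟨ regroup y c i ⟩
  y + i + c    ≡⟨ cong (_+ c) (trans (+-comm y i) i+y≡r) ⟩
  r + c        ≡⟨ +-comm r c ⟩
  c + r        ∎))
  where
  open ≡-Reasoning
  regroup : ∀ a b c → a + b + c ≡ a + c + b
  regroup = solve-∀

rotate-self : ∀ {r} (x : Fin r) → toℕ (rotate (toℕ x) (toℕ<n x) x) ≡ 0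
rotate-self x with proj₂ (rotation (toℕ x) (toℕ<n x) x)
... | inj₁ (_ , y+x≡x) = +-cancelʳ-≡ (toℕ x) _ 0 y+x≡x
... | inj₂ (x<x , _) = ⊥-elim (<-irrefl refl x<x)

reflect-zero : ∀ {r} (x : Fin r) → toℕ x ≡ 0 → toℕ (reflect x) ≡ 0
reflect-zero x x≡0 with proj₂ (reflection x)
... | inj₁ (_ , rx≡0) = rx≡0
... | inj₂ (x≢0 , _) = ⊥-elim (x≢0 x≡0)

reflect-last : ∀ {r} → 2 ≤ r → (x : Fin r) → suc (toℕ x) ≡ r → toℕ (reflect x) ≡ 1
reflect-last r≥2 x sx≡r with proj₂ (reflection x)
... | inj₁ (x≡0 , _) = ⊥-elim (<⇒≢ r≥2 (trans (cong suc (sym x≡0)) sx≡r))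
... | inj₂ (_ , rx+x≡r) = +-cancelʳ-≡ (toℕ x) _ 1 (trans rx+x≡r (sym sx≡r))

rotate-position : ∀ {r} c (c<r : c < r) (x i : Fin r) → toℕ (rotate c c<r x) ≡ toℕ i →
  (toℕ x ≡ toℕ i + c) ⊎ (toℕ x + r ≡ toℕ i + c)
rotate-position c c<r x i y≡i with proj₂ (rotation c c<r x)
... | inj₁ (_ , y+c≡x) = inj₁ (trans (sym y+c≡x) (cong (_+ c) y≡i))
... | inj₂ (_ , y+c≡x+r) = inj₂ (trans (sym y+c≡x+r) (cong (_+ c) y≡i))

reflect-rotate-position : ∀ {r} c (c<r : c < r) (x i : Fin r) → toℕ (reflect (rotate c c<r x)) ≡ toℕ i →
  (toℕ x + toℕ i ≡ c) ⊎ (toℕ x + toℕ i ≡ c + r)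
reflect-rotate-position {r} c c<r x i z≡i = rotated-reflected c<r (proj₂ (rotation c c<r x))
  (subst (Reflected r (toℕ (rotate c c<r x))) z≡i (proj₂ (reflection (rotate c c<r x))))

-- The symmetries of a cycle are the rotations and the reflections: rotating f(0)
-- back to 0 gives a symmetry h fixing 0, which sends 1 to 1 or r − 1; in the
-- latter case reflect once more.  Rigidity then makes the result the identity.
cycleSymmetry : ∀ {r} → 3 ≤ r → (f g : Fin r → Fin r) → (∀ j → f (g j) ≡ j) → (∀ i → g (f i) ≡ i) →
  (∀ i j → CycAdj r i j ⇔ CycAdj r (f i) (f j)) → Reorder true r f
cycleSymmetry {r} r≥3 f g fg gf adj = byImageOfOne (zeroNeighbours (h-preserves z one (inj₁ (inj₁ z→one))) hz≡0)
  where
  1<r : 1 < r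
  1<r = ≤-trans (s≤s (s≤s z≤n)) r≥3
  z one : Fin r
  z = fromℕ< (<-trans z<s 1<r)
  one = fromℕ< 1<r
  z≡0 : toℕ z ≡ 0
  z≡0 = toℕ-fromℕ< _
  one≡1 : toℕ one ≡ 1
  one≡1 = toℕ-fromℕ< 1<r
  z→one : suc (toℕ z) ≡ toℕ one
  z→one = trans (cong suc z≡0) (sym one≡1)
  c : ℕ
  c = toℕ (f z)
  c<r : c < r
  c<r = toℕ<n (f z)
  h : Fin r → Fin r
  h = rotate c c<r ∘ f
  h-injective : Injective _≡_ _≡_ h
  h-injective = inverse-injective {g = g} gf ∘ rotate-injective c c<r
  h-preserves : ∀ i j → CycAdj r i j → CycAdj r (h i) (h j)
  h-preserves i j = rotate-cycAdj c c<r ∘ to (adj i j)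
  hz≡0 : toℕ (h z) ≡ 0
  hz≡0 = rotate-self (f z)
  byImageOfOne : (toℕ (h one) ≡ 1) ⊎ (suc (toℕ (h one)) ≡ r) → Reorder true r f
  byImageOfOne (inj₁ h1≡1) = inj₂ (inj₂ (refl , c , c<r , inj₁ λ i → rotate-position c c<r (f i) i (h≡id i)))
    where
    h≡id : ∀ i → toℕ (h i) ≡ toℕ i
    h≡id = fixes-all true h h-injective h-preserves (fixedValue h z z≡0 hz≡0) (fixedValue h one one≡1 h1≡1)
  byImageOfOne (inj₂ sh1≡r) = inj₂ (inj₂ (refl , c , c<r , inj₂ λ i → reflect-rotate-position c c<r (f i) i (k≡id i)))
    where
    k : Fin r → Fin r
    k = reflect ∘ h
    k≡id : ∀ i → toℕ (k i) ≡ toℕ i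
    k≡id = fixes-all true k (h-injective ∘ reflect-injective)
      (λ i j → reflect-cycAdj (≤-trans (n≤1+n 2) r≥3) ∘ h-preserves i j)
      (fixedValue k z z≡0 (reflect-zero (h z) hz≡0))
      (fixedValue k one one≡1 (reflect-last (≤-trans (n≤1+n 2) r≥3) (h one) sh1≡r))

columnSymmetry : ∀ {r} → 3 ≤ r → (b b′ : Bool) (f g : Fin r → Fin r) → (∀ j → f (g j) ≡ j) → (∀ i → g (f i) ≡ i) →
  (∀ i j → ColAdj b r i j ⇔ ColAdj b′ r (f i) (f j)) → Reorder b r f
columnSymmetry r≥3 false false f g fg gf adj = pathSymmetry (≤-trans (s≤s z≤n) r≥3) f g fg gf adj
columnSymmetry r≥3 false true f g fg gf adj = ⊥-elim (path≢cycle r≥3 f g fg adj)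
columnSymmetry r≥3 true false f g fg gf adj = ⊥-elim (path≢cycle r≥3 g f gf adj⁻¹)
  where
  adj⁻¹ : ∀ i j → LinAdj i j ⇔ CycAdj _ (g i) (g j)
  adj⁻¹ i j = mk⇔ (from (adj (g i) (g j)) ∘ subst₂ LinAdj (sym (fg i)) (sym (fg j)))
                  (subst₂ LinAdj (fg i) (fg j) ∘ to (adj (g i) (g j)))
columnSymmetry r≥3 true true f g fg gf adj = cycleSymmetry r≥3 f g fg gf adj

representativesThrough : ∀ {n k} {G : Matrix (Fin n)} (Q : Profile G k) (x y : Fin n) → col Q x ≢ col Q y →
  Σ[ v ∈ (Fin k → Fin n) ] (∀ i → col Q (v i) ≡ i) × (v (col Q x) ≡ x) × (v (col Q y) ≡ y)
representativesThrough {n} {k} Q x y x≁y = proj₁ ∘ pick , proj₂ ∘ pick , pick-x , pick-y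
  where
  pick : ∀ i → Σ[ z ∈ Fin n ] col Q z ≡ i
  pick i with i ≟ᶠ col Q x | i ≟ᶠ col Q y
  ... | yes i≡x | _ = x , sym i≡x
  ... | no _ | yes i≡y = y , sym i≡y
  ... | no _ | no _ = nonempty Q i
  pick-x : proj₁ (pick (col Q x)) ≡ x
  pick-x with col Q x ≟ᶠ col Q x
  ... | yes _ = refl
  ... | no x≢x = ⊥-elim (x≢x refl)
  pick-y : proj₁ (pick (col Q y)) ≡ y
  pick-y with col Q y ≟ᶠ col Q x | col Q y ≟ᶠ col Q y
  ... | yes y≡x | _ = ⊥-elim (x≁y (sym y≡x))
  ... | no _ | yes _ = refl
  ... | no _ | no y≢y = ⊥-elim (y≢y refl)

-- Two profiles with r ≥ 5 columns have the same columns: if x, y were in different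
-- columns of Q, a system of representatives of Q through x and y would be a
-- chordless path or cycle on which the columns of P are pairwise different.
sameColumns : ∀ {n r} {G : Matrix (Fin n)} → 5 ≤ r → (P Q : Profile G r) →
  ∀ x y → col P x ≡ col P y → col Q x ≡ col Q y
sameColumns {G = G} r≥5 P Q x y Px≡Py with col Q x ≟ᶠ col Q y
... | yes Qx≡Qy = Qx≡Qy
... | no Qx≢Qy with representativesThrough Q x y Qx≢Qy
...   | v , cv , vx≡x , vy≡y = twins-injective {G = G} (columns-twins (columnsOf P)) r≥5 (representatives-chordless (columnsOf Q) (profile-2≤k Q) v cv)
                                 (trans (cong (col P) vx≡x) (trans Px≡Py (sym (cong (col P) vy≡y))))

-- Uniqueness: the columns of two profiles with r ≥ 5 columns agree up to a
-- renumbering φ, and φ preserves column adjacency, so it is a reordering.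
profilesUnique : ∀ {n r} {G : Matrix (Fin n)} → 5 ≤ r → (P Q : Profile G r) →
  Σ[ φ ∈ (Fin r → Fin r) ] Reorder (cycling P) r φ × (∀ x → col Q x ≡ φ (col P x))
profilesUnique {r = r} {G} r≥5 P Q =
  φ , columnSymmetry (three≤k P) (cycling P) (cycling Q) φ ψ φψ ψφ adjacency , Q≡φP
  where
  vP vQ : Fin r → _
  vP = proj₁ (representatives P)
  vQ = proj₁ (representatives Q)
  φ ψ : Fin r → Fin r
  φ = col Q ∘ vP
  ψ = col P ∘ vQ
  Q≡φP : ∀ x → col Q x ≡ φ (col P x)
  Q≡φP x = sameColumns r≥5 P Q x (vP (col P x)) (sym (proj₂ (nonempty P (col P x))))
  P≡ψQ : ∀ x → col P x ≡ ψ (col Q x)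
  P≡ψQ x = sameColumns r≥5 Q P x (vQ (col Q x)) (sym (proj₂ (nonempty Q (col Q x))))
  φψ : ∀ j → φ (ψ j) ≡ j
  φψ j = trans (sym (Q≡φP (vQ j))) (proj₂ (nonempty Q j))
  ψφ : ∀ i → ψ (φ i) ≡ i
  ψφ i = trans (sym (P≡ψQ (vP i))) (proj₂ (nonempty P i))
  adjacency : ∀ i j → ColAdj (cycling P) r i j ⇔ ColAdj (cycling Q) r (φ i) (φ j)
  adjacency i j with i ≟ᶠ j
  ... | yes refl = mk⇔ (⊥-elim ∘ colAdj-irrefl (cycling P) (profile-2≤k P) i)
                       (⊥-elim ∘ colAdj-irrefl (cycling Q) (profile-2≤k Q) (φ i))
  ... | no i≢j = columns-edgeAcross (columnsOf Q) (vP i) (vP j) (λ φi≡φj → i≢j (trans (sym (ψφ i)) (trans (cong ψ φi≡φj) (ψφ j))))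
                 ⇔-∘ ⇔-sym (proj₂ (proj₂ (representatives P)) i j)

edge-sym : ∀ {n} {G : Matrix (Fin n)} → IsCSG G → ∀ {x y} → Edge G x y → Edge G y x
edge-sym symmetric {x} {y} (x≢y , nonzero) = x≢y ∘ sym , nonzero ∘ trans (symmetric x y)

isZer? : (t : Tri) → Dec (t ≡ zer)
isZer? neg = no (λ ())
isZer? zer = yes refl
isZer? pos = no (λ ())

edge? : ∀ {n} (G : Matrix (Fin n)) x y → Dec (Edge G x y)
edge? G x y = ¬? (x ≟ᶠ y) ×-dec ¬? (isZer? (G x y))

walk-exit : ∀ {V : Set} {A : Matrix V} (Q : V → Set) → (∀ x → Dec (Q x)) → ∀ {s t} → Reach A s t → Q s →
  Q t ⊎ Σ[ w ∈ V ] Σ[ w′ ∈ V ] Edge A w w′ × Q w × ¬ Q w′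
walk-exit Q Q? here Qs = inj₁ Qs
walk-exit Q Q? (step {y = y} s∼y rest) Qs with Q? y
... | yes Qy = walk-exit Q Q? rest Qy
... | no ¬Qy = inj₂ (_ , _ , s∼y , Qs , ¬Qy)

prepend : ∀ {n r} → Fin n → (Fin r → Fin n) → Fin (suc r) → Fin n
prepend y v fzero = y
prepend y v (fsuc i) = v i

linAdj-shift : ∀ {r} (i j : Fin r) → LinAdj i j ⇔ LinAdj (fsuc i) (fsuc j)
linAdj-shift i j = mk⇔ (⊎-map (cong suc) (cong suc)) (⊎-map suc-injective suc-injective)

prepend-chordless : ∀ b {n r} {G : Matrix (Fin n)} {v : Fin r → Fin n} {y : Fin n} → IsCSG G → 1 ≤ r →
  IsChordless G false r v → (∀ m → y ≢ v m) →
  (∀ m → Edge G y (v m) ⇔ ColAdj b (suc r) fzero (fsuc m)) →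
  (∀ i j → LinAdj i j ⇔ ColAdj b (suc r) (fsuc i) (fsuc j)) →
  IsChordless G b (suc r) (prepend y v)
prepend-chordless b {r = r} {G} {v} {y} symmetric r≥1 (v-inj , v-edges) y∉v y-edges shifted = u-inj , u-edges
  where
  u-inj : Injective _≡_ _≡_ (prepend y v)
  u-inj {fzero} {fzero} _ = refl
  u-inj {fzero} {fsuc j} y≡vj = ⊥-elim (y∉v j y≡vj)
  u-inj {fsuc i} {fzero} vi≡y = ⊥-elim (y∉v i (sym vi≡y))
  u-inj {fsuc i} {fsuc j} vi≡vj = cong fsuc (v-inj vi≡vj)
  u-edges : ∀ i j → Edge G (prepend y v i) (prepend y v j) ⇔ ColAdj b (suc r) i j
  u-edges fzero fzero = mk⇔ (λ loop → ⊥-elim (proj₁ loop refl)) (⊥-elim ∘ colAdj-irrefl b (s≤s r≥1) fzero)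
  u-edges fzero (fsuc j) = y-edges j
  u-edges (fsuc i) fzero = mk⇔ (colAdj-sym b ∘ to (y-edges i) ∘ edge-sym symmetric)
                               (edge-sym symmetric ∘ from (y-edges i) ∘ colAdj-sym b)
  u-edges (fsuc i) (fsuc j) = shifted i j ⇔-∘ v-edges i j

extendPath : ∀ {n r} {G : Matrix (Fin n)} {v : Fin r → Fin n} {y : Fin n} → IsCSG G → 1 ≤ r →
  IsChordless G false r v → (∀ m → y ≢ v m) → (∀ m → Edge G y (v m) ⇔ (toℕ m ≡ 0)) →
  Chordless G false (suc r)
extendPath symmetric r≥1 path y∉v y-edges =
  _ , prepend-chordless false symmetric r≥1 path y∉v (λ m → atStart m ⇔-∘ y-edges m) linAdj-shift
  where
  atStart : ∀ {r} (m : Fin r) → (toℕ m ≡ 0) ⇔ LinAdj fzero (fsuc m)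
  atStart m = mk⇔ (λ m≡0 → inj₁ (cong suc (sym m≡0))) λ { (inj₁ 1≡sm) → sym (suc-injective 1≡sm) ; (inj₂ ()) }

closePath : ∀ {n r} {G : Matrix (Fin n)} {v : Fin r → Fin n} {y : Fin n} → IsCSG G → 1 ≤ r →
  IsChordless G false r v → (∀ m → y ≢ v m) → (∀ m → Edge G y (v m) ⇔ ((toℕ m ≡ 0) ⊎ (suc (toℕ m) ≡ r))) →
  Chordless G true (suc r)
closePath {r = r} symmetric r≥1 path y∉v y-edges =
  _ , prepend-chordless true symmetric r≥1 path y∉v (λ m → atEnds m ⇔-∘ y-edges m) shifted
  where
  atEnds : (m : Fin r) → ((toℕ m ≡ 0) ⊎ (suc (toℕ m) ≡ r)) ⇔ CycAdj (suc r) fzero (fsuc m)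
  atEnds m = mk⇔ (λ { (inj₁ m≡0) → inj₁ (inj₁ (cong suc (sym m≡0))) ; (inj₂ sm≡r) → inj₂ (inj₁ (refl , cong suc sm≡r)) })
                 (λ { (inj₁ (inj₁ 1≡sm)) → inj₁ (sym (suc-injective 1≡sm)) ; (inj₁ (inj₂ ()))
                    ; (inj₂ (inj₁ (_ , ssm≡sr))) → inj₂ (suc-injective ssm≡sr) ; (inj₂ (inj₂ (() , _))) })
  shifted : ∀ i j → LinAdj i j ⇔ CycAdj (suc r) (fsuc i) (fsuc j)
  shifted i j = mk⇔ (inj₁ ∘ to (linAdj-shift i j))
                    (λ { (inj₁ lin) → from (linAdj-shift i j) lin ; (inj₂ (inj₁ (() , _))) ; (inj₂ (inj₂ (() , _))) })

reversePath : ∀ {n r} {G : Matrix (Fin n)} {v : Fin r → Fin n} → IsChordless G false r v → IsChordless G false r (v ∘ opposite)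
reversePath {v = v} (v-inj , v-edges) =
  opposite-injective ∘ v-inj , λ i j → mk⇔
    (subst₂ LinAdj (opposite-involutive i) (opposite-involutive j) ∘ opposite-linAdj ∘ to (v-edges (opposite i) (opposite j)))
    (from (v-edges (opposite i) (opposite j)) ∘ opposite-linAdj)

opposite-first : ∀ {r} (m : Fin r) → (toℕ m ≡ 0) ⇔ (suc (toℕ (opposite m)) ≡ r)
opposite-first m = mk⇔
  (λ m≡0 → trans (+-comm 1 (toℕ (opposite m))) (trans (cong (λ t → toℕ (opposite m) + suc t) (sym m≡0)) (opposite-sum m)))
  (λ so≡r → suc-injective (+-cancelˡ-≡ (toℕ (opposite m)) _ 1 (trans (opposite-sum m) (trans (sym so≡r) (+-comm 1 _)))))

-- The columns met by v are pairwise different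
-- (twins-injective), and every vertex lies in a met column: otherwise some edge
-- leaves the met columns, and then either a met column has three adjacent
-- columns, or the new vertex extends v to a longer chordless path or cycle.
-- Numbering the columns by their position along v then gives the profile.
module Existence {n k b r} {G : Matrix (Fin n)} (symmetric : IsCSG G) (connected : Connected G)
  (M : ColumnMap G b k) (k≥2 : 2 ≤ k) (maximal : ∀ r′ → HasChordless G r′ → r′ ≤ r) (r≥5 : 5 ≤ r)
  (b′ : Bool) (v : Fin r → Fin n) (chordless : IsChordless G b′ r v) where

  c : Fin n → Fin k
  c = column M

  met-injective : Injective _≡_ _≡_ (c ∘ v)
  met-injective = twins-injective {G = G} (columns-twins M) r≥5 chordless

  Met : Fin n → Set
  Met x = Σ[ i ∈ Fin r ] c (v i) ≡ c x

  met? : ∀ x → Dec (Met x)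
  met? x = any? (λ i → c (v i) ≟ᶠ c x)

  tooLong : ¬ HasChordless G (suc r)
  tooLong longer = 1+n≰n (maximal (suc r) longer)

  0<r : 0 < r
  0<r = ≤-trans (s≤s z≤n) r≥5
  r≥2 : 2 ≤ r
  r≥2 = ≤-trans (s≤s (s≤s z≤n)) r≥5
  r≥3 : 3 ≤ r
  r≥3 = ≤-trans (s≤s (s≤s (s≤s z≤n))) r≥5

  first last : Fin r
  first = fromℕ< 0<r
  last = opposite first

  isFirst : ∀ m → toℕ m ≡ 0 → m ≡ first
  isFirst m m≡0 = toℕ-injective (trans m≡0 (sym (toℕ-fromℕ< 0<r)))

  isLast : ∀ m → suc (toℕ m) ≡ r → m ≡ last
  isLast m sm≡r = toℕ-injective (suc-injective (trans sm≡r (sym (to (opposite-first first) (toℕ-fromℕ< 0<r)))))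

  pathColumns : ∀ β → IsChordless G β r v → ∀ {m p} → ColAdj β r m p → ColAdj b k (c (v m)) (c (v p))
  pathColumns β (_ , v-edges) {m} {p} m∼p =
    to (columns-edgeAcross M (v m) (v p) (λ cm≡cp → colAdj-irrefl β r≥2 p
      (subst (λ q → ColAdj β r q p) (met-injective cm≡cp) m∼p)))
      (from (v-edges m p) m∼p)

  module Outside (y : Fin n) (unmet : ¬ Met y) where

    y∉v : ∀ m → y ≢ v m
    y∉v m y≡vm = unmet (m , cong c (sym y≡vm))

    across : ∀ m → Edge G y (v m) ⇔ ColAdj b k (c (v m)) (c y)
    across m = mk⇔ (colAdj-sym b ∘ to edge) (from edge ∘ colAdj-sym b)
      where
      edge : Edge G y (v m) ⇔ ColAdj b k (c y) (c (v m))
      edge = columns-edgeAcross M y (v m) (λ cy≡cm → unmet (m , sym cy≡cm))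

    blocked : ∀ β → IsChordless G β r v → ∀ {m p q} → ColAdj β r m p → ColAdj β r m q → p ≢ q →
      ¬ ColAdj b k (c (v m)) (c y)
    blocked β path m∼p m∼q p≢q m∼y with colAdj-degree≤2 b (pathColumns β path m∼p) (pathColumns β path m∼q) m∼y
    ... | inj₁ cp≡cq = p≢q (met-injective cp≡cq)
    ... | inj₂ (inj₁ cq≡cy) = unmet (_ , cq≡cy)
    ... | inj₂ (inj₂ cp≡cy) = unmet (_ , cp≡cy)

    endsOnly : IsChordless G false r v → ∀ m → ColAdj b k (c (v m)) (c y) → (toℕ m ≡ 0) ⊎ (suc (toℕ m) ≡ r)
    endsOnly path m m∼y = byValue (toℕ m) refl
      where
      byValue : ∀ a → toℕ m ≡ a → (toℕ m ≡ 0) ⊎ (suc (toℕ m) ≡ r)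
      byValue zero m≡0 = inj₁ m≡0
      byValue (suc a) m≡sa with suc (suc a) ≟ r
      ... | yes ssa≡r = inj₂ (trans (cong suc m≡sa) ssa≡r)
      ... | no ssa≢r with innerNeighbours false m m≡sa (≤∧≢⇒< (subst (_< r) m≡sa (toℕ<n m)) ssa≢r)
      ...   | p , q , m∼p , m∼q , p≢q = ⊥-elim (blocked false path m∼p m∼q p≢q m∼y)

    -- On a path, y adjacent to one or both ends would extend v, or close it into
    -- a cycle, contradicting maximality.
    module AtEnds (path : IsChordless G false r v) where

      bothEnds : Edge G y (v first) → Edge G y (v last) → ⊥
      bothEnds y∼first y∼last = tooLong (hasChordless {G = G} true (≤-trans r≥3 (n≤1+n r))
        (closePath symmetric 0<r path y∉v (λ m → mk⇔ (endsOnly path m ∘ to (across m)) atEnd)))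
        where
        atEnd : ∀ {m} → (toℕ m ≡ 0) ⊎ (suc (toℕ m) ≡ r) → Edge G y (v m)
        atEnd {m} (inj₁ m≡0) = subst (Edge G y ∘ v) (sym (isFirst m m≡0)) y∼first
        atEnd {m} (inj₂ sm≡r) = subst (Edge G y ∘ v) (sym (isLast m sm≡r)) y∼last

      firstOnly : Edge G y (v first) → ¬ Edge G y (v last) → ⊥
      firstOnly y∼first y≁last = tooLong (inj₁ (extendPath symmetric 0<r path y∉v (λ m → mk⇔ (atFirst m) (atStart m))))
        where
        atFirst : ∀ m → Edge G y (v m) → toℕ m ≡ 0
        atFirst m y∼m with endsOnly path m (to (across m) y∼m)
        ... | inj₁ m≡0 = m≡0
        ... | inj₂ sm≡r = ⊥-elim (y≁last (subst (Edge G y ∘ v) (isLast m sm≡r) y∼m))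
        atStart : ∀ m → toℕ m ≡ 0 → Edge G y (v m)
        atStart m m≡0 = subst (Edge G y ∘ v) (sym (isFirst m m≡0)) y∼first

      lastOnly : ¬ Edge G y (v first) → Edge G y (v last) → ⊥
      lastOnly y≁first y∼last =
        tooLong (inj₁ (extendPath symmetric 0<r (reversePath {G = G} path) (y∉v ∘ opposite) (λ m → mk⇔ (atFirst m) (atStart m))))
        where
        atFirst : ∀ m → Edge G y (v (opposite m)) → toℕ m ≡ 0
        atFirst m y∼m with endsOnly path (opposite m) (to (across (opposite m)) y∼m)
        ... | inj₁ o≡0 = ⊥-elim (y≁first (subst (Edge G y ∘ v) (isFirst (opposite m) o≡0) y∼m))
        ... | inj₂ so≡r = from (opposite-first m) so≡r
        atStart : ∀ m → toℕ m ≡ 0 → Edge G y (v (opposite m))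
        atStart m m≡0 = subst (Edge G y ∘ v) (sym (isLast (opposite m) (to (opposite-first m) m≡0))) y∼last

      neither : ¬ Edge G y (v first) → ¬ Edge G y (v last) → ∀ m → ¬ ColAdj b k (c (v m)) (c y)
      neither y≁first y≁last m m∼y with endsOnly path m m∼y
      ... | inj₁ m≡0 = y≁first (from (across first) (subst (λ q → ColAdj b k (c (v q)) (c y)) (isFirst m m≡0) m∼y))
      ... | inj₂ sm≡r = y≁last (from (across last) (subst (λ q → ColAdj b k (c (v q)) (c y)) (isLast m sm≡r) m∼y))

    unreachable : ∀ β → IsChordless G β r v → ∀ m → ¬ ColAdj b k (c (v m)) (c y)
    unreachable true cycle m with cycleNeighbours r≥3 m
    ... | p , q , m∼p , m∼q , p≢q = blocked true cycle m∼p m∼q p≢q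
    unreachable false path m with edge? G y (v first) | edge? G y (v last)
    ... | yes y∼first | yes y∼last = ⊥-elim (AtEnds.bothEnds path y∼first y∼last)
    ... | yes y∼first | no y≁last = ⊥-elim (AtEnds.firstOnly path y∼first y≁last)
    ... | no y≁first | yes y∼last = ⊥-elim (AtEnds.lastOnly path y≁first y∼last)
    ... | no y≁first | no y≁last = AtEnds.neither path y≁first y≁last m

  -- Every vertex lies in a column met by v: walk to it from v, and no edge leaves the met columns.
  covered : ∀ x → Met x
  covered x with met? x
  ... | yes met = met
  ... | no unmet with walk-exit Met met? (connected (v first) x) (first , refl)
  ...   | inj₁ met = ⊥-elim (unmet met)
  ...   | inj₂ (w , y , w∼y , (i , ci≡cw) , unmet-y) = ⊥-elim (Outside.unreachable y unmet-y b′ chordless i i∼y)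
    where
    i∼y : ColAdj b k (c (v i)) (c y)
    i∼y = subst (λ d → ColAdj b k d (c y)) (sym ci≡cw)
            (to (columns-edgeAcross M w y (λ cw≡cy → unmet-y (i , trans ci≡cw cw≡cy))) w∼y)

  position : Fin n → Fin r
  position x = proj₁ (covered x)

  position-column : ∀ x → c (v (position x)) ≡ c x
  position-column x = proj₂ (covered x)

  samePosition : ∀ {x y} → position x ≡ position y → c x ≡ c y
  samePosition {x} {y} px≡py = trans (sym (position-column x)) (trans (cong (c ∘ v) px≡py) (position-column y))

  differentPosition : ∀ {x y} → position x ≢ position y → c x ≢ c y
  differentPosition {x} {y} px≢py cx≡cy = px≢py (met-injective (trans (position-column x) (trans cx≡cy (sym (position-column y)))))

  position-edges : ∀ x y → x ≢ y →
    Edge G x y ⇔ (ColAdj b′ r (position x) (position y) ⊎ ((position x ≡ position y) × (charge G x ≢ zer)))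
  position-edges x y x≢y with position x ≟ᶠ position y
  ... | yes px≡py = mk⇔ sameColumnEdge (from (edgesBetween M x y x≢y) ∘ inj₂ ∘ chargedIn)
    where
    sameColumnEdge : Edge G x y → ColAdj b′ r (position x) (position y) ⊎ ((position x ≡ position y) × (charge G x ≢ zer))
    sameColumnEdge x∼y with to (edgesBetween M x y x≢y) x∼y
    ... | inj₁ adjacent = ⊥-elim (colAdj-irrefl b k≥2 (c y) (subst (λ d → ColAdj b k d (c y)) (samePosition px≡py) adjacent))
    ... | inj₂ (_ , charged) = inj₂ (px≡py , charged)
    chargedIn : ColAdj b′ r (position x) (position y) ⊎ ((position x ≡ position y) × (charge G x ≢ zer)) →
      (c x ≡ c y) × (charge G x ≢ zer)
    chargedIn (inj₁ adjacent) = ⊥-elim (colAdj-irrefl b′ r≥2 (position y) (subst (λ p → ColAdj b′ r p (position y)) px≡py adjacent))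
    chargedIn (inj₂ (_ , charged)) = samePosition px≡py , charged
  ... | no px≢py = mk⇔ (inj₁ ∘ to alongV) (λ { (inj₁ adjacent) → from alongV adjacent ; (inj₂ (px≡py , _)) → ⊥-elim (px≢py px≡py) })
    where
    -- x, y are adjacent iff their columns are, iff the vertices of v in these columns are
    alongV : Edge G x y ⇔ ColAdj b′ r (position x) (position y)
    alongV = proj₂ chordless (position x) (position y)
      ⇔-∘ (⇔-sym (columns-edgeAcross M (v (position x)) (v (position y)) (px≢py ∘ met-injective))
      ⇔-∘ (columnsOnV ⇔-∘ columns-edgeAcross M x y (differentPosition px≢py)))
      where
      columnsOnV : ColAdj b k (c x) (c y) ⇔ ColAdj b k (c (v (position x))) (c (v (position y)))
      columnsOnV = mk⇔ (subst₂ (ColAdj b k) (sym (position-column x)) (sym (position-column y)))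
                       (subst₂ (ColAdj b k) (position-column x) (position-column y))

  profile : Profile G r
  profile = record
    { col = position
    ; cycling = b′
    ; three≤k = r≥3
    ; nonempty = λ i → v i , met-injective (position-column (v i))
    ; atMostTwo = λ x y z px≡py py≡pz → atMostTwoEach M x y z (samePosition px≡py) (samePosition py≡pz)
    ; uniform = λ x y px≡py → sameCharge M x y (samePosition px≡py)
    ; edges = position-edges
    }

profileExists : ∀ {n k b r} {G : Matrix (Fin n)} → IsCSG G → Connected G → ColumnMap G b k → 2 ≤ k →
  PathRank G r → 5 ≤ r → Profile G r
profileExists {G = G} symmetric connected M k≥2 (longest , maximal) r≥5 with chordlessOf {G = G} longest
... | b′ , v , chordless = Existence.profile symmetric connected M k≥2 maximal r≥5 b′ v chordless

-- The graphs T_{2k}, C_{2k}^{++}, C_{2k}^{+-} on Fin k × Bool have the column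
-- map (i , a) ↦ i onto a cycle or path of k columns {u_i, w_i}: across columns
-- there is an edge iff the columns are adjacent, within a column iff it is
-- charged, and charges are constant on columns.
record AmbientColumns (b : Bool) (k : ℕ) (H : Matrix (Fin k × Bool)) : Set where
  field
    across         : ∀ i j a a′ → i ≢ j → (H (i , a) (j , a′) ≢ zer) ⇔ ColAdj b k i j
    within         : ∀ i a a′ → (H (i , a) (i , a′) ≢ zer) ⇔ (H (i , a) (i , a) ≢ zer)
    constantCharge : ∀ i a a′ → H (i , a) (i , a) ≡ H (i , a′) (i , a′)

open AmbientColumns

≢zer-cong : ∀ {s t : Tri} → s ≡ t → (s ≢ zer) ⇔ (t ≢ zer)
≢zer-cong s≡t = mk⇔ (λ s≢0 t≡0 → s≢0 (trans s≡t t≡0)) (λ t≢0 s≡0 → t≢0 (trans (sym s≡t) s≡0))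

act-nonzero : ∀ ε t → (act ε t ≢ zer) ⇔ (t ≢ zer)
act-nonzero plus t = mk⇔ (λ t≢0 → t≢0) (λ t≢0 → t≢0)
act-nonzero minus neg = mk⇔ (λ _ ()) (λ _ ())
act-nonzero minus zer = mk⇔ (λ t≢0 → t≢0) (λ t≢0 → t≢0)
act-nonzero minus pos = mk⇔ (λ _ ()) (λ _ ())

act-involutive : ∀ ε t → act ε (act ε t) ≡ t
act-involutive plus t = refl
act-involutive minus neg = refl
act-involutive minus zer = refl
act-involutive minus pos = refl

inheritColumns : ∀ {n k b} {G : Matrix (Fin n)} {H : Matrix (Fin k × Bool)} → 2 ≤ k →
  AmbientColumns b k H → EquivConnSub G H → ColumnMap G b k × Connected G
inheritColumns {n} {k} {b} {G} {H} k≥2 A (ι , ι-inj , connectedSub , σ , ε , s , G≡) = M , connected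
  where
  h : Fin n → Fin k × Bool
  h x = ι (σ ⟨$⟩ʳ x)
  c : Fin n → Fin k
  c = proj₁ ∘ h
  h-inj : ∀ {x y} → h x ≡ h y → x ≡ y
  h-inj {x} {y} hx≡hy = trans (sym (inverseˡ σ)) (trans (cong (σ ⟨$⟩ˡ_) (ι-inj hx≡hy)) (inverseˡ σ))
  nonzero : ∀ x y → (G x y ≢ zer) ⇔ (H (h x) (h y) ≢ zer)
  nonzero x y = act-nonzero (s y) _ ⇔-∘ (act-nonzero (s x) _ ⇔-∘ (act-nonzero ε _ ⇔-∘ ≢zer-cong (G≡ x y)))
  charge≡ : ∀ x → charge G x ≡ act ε (H (h x) (h x))
  charge≡ x = trans (G≡ x x) (cong (act ε) (act-involutive (s x) _))
  chargedIff : ∀ x → (charge G x ≢ zer) ⇔ (H (h x) (h x) ≢ zer)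
  chargedIff x = act-nonzero ε _ ⇔-∘ ≢zer-cong (charge≡ x)

  edges≡ : ∀ x y → x ≢ y → Edge G x y ⇔ (ColAdj b k (c x) (c y) ⊎ ((c x ≡ c y) × (charge G x ≢ zer)))
  edges≡ x y x≢y with c x ≟ᶠ c y
  ... | no cx≢cy = mk⇔ (λ x∼y → inj₁ (to acrossG (proj₂ x∼y)))
                       (λ { (inj₁ adjacent) → x≢y , from acrossG adjacent ; (inj₂ (cx≡cy , _)) → ⊥-elim (cx≢cy cx≡cy) })
    where
    acrossG : (G x y ≢ zer) ⇔ ColAdj b k (c x) (c y)
    acrossG = across A (c x) (c y) (proj₂ (h x)) (proj₂ (h y)) cx≢cy ⇔-∘ nonzero x y
  ... | yes cx≡cy = mk⇔ (λ x∼y → inj₂ (cx≡cy , to withinG (proj₂ x∼y)))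
                        (λ { (inj₁ adjacent) → ⊥-elim (colAdj-irrefl b k≥2 (c y) (subst (λ d → ColAdj b k d (c y)) cx≡cy adjacent))
                           ; (inj₂ (_ , charged)) → x≢y , from withinG charged })
    where
    sameColumn : H (h x) (h y) ≡ H (c x , proj₂ (h x)) (c x , proj₂ (h y))
    sameColumn = cong (λ j → H (h x) (j , proj₂ (h y))) (sym cx≡cy)
    withinG : (G x y ≢ zer) ⇔ (charge G x ≢ zer)
    withinG = ⇔-sym (chargedIff x) ⇔-∘ (within A (c x) (proj₂ (h x)) (proj₂ (h y)) ⇔-∘ (≢zer-cong sameColumn ⇔-∘ nonzero x y))

  sameSide : ∀ {x y} → c x ≡ c y → proj₂ (h x) ≡ proj₂ (h y) → x ≡ y
  sameSide cx≡cy side≡ = h-inj (cong₂ _,_ cx≡cy side≡)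

  atMostTwo′ : ∀ x y z → c x ≡ c y → c y ≡ c z → (x ≡ y) ⊎ (y ≡ z) ⊎ (x ≡ z)
  atMostTwo′ x y z cx≡cy cy≡cz with
    pigeonhole (_≡ false) (_≡ true) (λ p q → trans p (sym q)) (λ p q → trans p (sym q))
      (side (proj₂ (h x))) (side (proj₂ (h y))) (side (proj₂ (h z)))
    where
    side : ∀ a → (a ≡ false) ⊎ (a ≡ true)
    side false = inj₁ refl
    side true = inj₂ refl
  ... | inj₁ x≡y = inj₁ (sameSide cx≡cy x≡y)
  ... | inj₂ (inj₁ y≡z) = inj₂ (inj₁ (sameSide cy≡cz y≡z))
  ... | inj₂ (inj₂ x≡z) = inj₂ (inj₂ (sameSide (trans cx≡cy cy≡cz) x≡z))

  sameCharge′ : ∀ x y → c x ≡ c y → charge G x ≡ charge G y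
  sameCharge′ x y cx≡cy = begin
    charge G x                                               ≡⟨ charge≡ x ⟩
    act ε (H (h x) (h x))                                    ≡⟨ cong (act ε) (constantCharge A (c x) (proj₂ (h x)) (proj₂ (h y))) ⟩
    act ε (H (c x , proj₂ (h y)) (c x , proj₂ (h y)))        ≡⟨ cong (λ j → act ε (H (j , proj₂ (h y)) (j , proj₂ (h y)))) cx≡cy ⟩
    act ε (H (h y) (h y))                                    ≡⟨ sym (charge≡ y) ⟩
    charge G y                                               ∎
    where open ≡-Reasoning

  M : ColumnMap G b k
  M = record { column = c ; atMostTwoEach = atMostTwo′ ; sameCharge = sameCharge′ ; edgesBetween = edges≡ }

  pullBack : ∀ {p q} → Reach (Induced H ι) p q → Reach G (σ ⟨$⟩ˡ p) (σ ⟨$⟩ˡ q)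
  pullBack here = here
  pullBack (step (p≢q , nz) rest) =
    step ((λ e → p≢q (trans (sym (inverseʳ σ)) (trans (cong (σ ⟨$⟩ʳ_) e) (inverseʳ σ)))) ,
          from (nonzero _ _) (subst₂ (λ u w → H (ι u) (ι w) ≢ zer) (sym (inverseʳ σ)) (sym (inverseʳ σ)) nz))
         (pullBack rest)

  connected : Connected G
  connected x y = subst₂ (Reach G) (inverseˡ σ) (inverseˡ σ) (pullBack (connectedSub (σ ⟨$⟩ʳ x) (σ ⟨$⟩ʳ y)))

if-nonzero : ∀ p q {x y z : Tri} → x ≢ zer → y ≢ zer →
  ((if p then x else if q then y else z) ≢ zer) ⇔ ((True p ⊎ True q) ⊎ (z ≢ zer))
if-nonzero true _ x≢0 _ = mk⇔ (λ _ → inj₁ (inj₁ tt)) (λ _ → x≢0)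
if-nonzero false true _ y≢0 = mk⇔ (λ _ → inj₁ (inj₂ tt)) (λ _ → y≢0)
if-nonzero false false _ _ = mk⇔ inj₂ λ { (inj₁ (inj₁ ())) ; (inj₁ (inj₂ ())) ; (inj₂ z≢0) → z≢0 }

if-zer-nonzero : ∀ p {x : Tri} → (if p then x else zer) ≢ zer → True p
if-zer-nonzero true _ = tt
if-zer-nonzero false nz = ⊥-elim (nz refl)

if-false : ∀ {A : Set} {p} {x y : A} → p ≡ false → (if p then x else y) ≡ y
if-false refl = refl

if-true : ∀ {A : Set} {p} {x y : A} → p ≡ true → (if p then x else y) ≡ x
if-true refl = refl

withoutRight : ∀ {A B : Set} → ¬ B → (A ⊎ B) ⇔ A
withoutRight ¬b = mk⇔ (λ { (inj₁ a) → a ; (inj₂ b) → ⊥-elim (¬b b) }) inj₁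

outSign-nonzero : ∀ a → outSign a ≢ zer
outSign-nonzero false ()
outSign-nonzero true ()

≡ᵇ-reflects : ∀ m n → True (m ≡ᵇ n) ⇔ (m ≡ n)
≡ᵇ-reflects m n = mk⇔ (≡ᵇ⇒≡ m n) (≡⇒≡ᵇ m n)

≡ᵇ-false : ∀ {m n} → m ≢ n → (m ≡ᵇ n) ≡ false
≡ᵇ-false {m} {n} m≢n with m ≡ᵇ n in eq
... | true = ⊥-elim (m≢n (≡ᵇ⇒≡ m n (subst True (sym eq) tt)))
... | false = refl

cycSucc-reflects : ∀ k (i j : Fin k) → True (cycSucc k i j) ⇔ CycSucc k (toℕ i) (toℕ j)
cycSucc-reflects k i j =
  (≡ᵇ-reflects _ _ ⊎-⇔ ((≡ᵇ-reflects _ _ ×-⇔ ≡ᵇ-reflects _ _) ⇔-∘ T-∧ {suc (toℕ i) ≡ᵇ k} {toℕ j ≡ᵇ 0}))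
  ⇔-∘ T-∨ {linSucc i j} {(suc (toℕ i) ≡ᵇ k) ∧ (toℕ j ≡ᵇ 0)}

T-columns : ∀ k → 2 ≤ k → AmbientColumns true k (T k)
T-columns k k≥2 = record
  { across = across′
  ; within = λ i a a′ → ≢zer-cong (trans (selfZero i a a′) (sym (selfZero i a a)))
  ; constantCharge = λ i a a′ → trans (selfZero i a a) (sym (selfZero i a′ a′))
  }
  where
  cycSucc-self : ∀ i → cycSucc k i i ≡ false
  cycSucc-self i with cycSucc k i i in eq
  ... | true = ⊥-elim (colAdj-irrefl true k≥2 i (succ→cycAdj (inj₁ (to (cycSucc-reflects k i i) (subst True (sym eq) tt)))))
  ... | false = refl
  selfZero : ∀ i a a′ → T k (i , a) (i , a′) ≡ zer
  selfZero i a a′ = trans (if-false (cycSucc-self i)) (if-false (cycSucc-self i))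
  across′ : ∀ i j a a′ → i ≢ j → (T k (i , a) (j , a′) ≢ zer) ⇔ CycAdj k i j
  across′ i j a a′ _ =
    mk⇔ (succ→cycAdj ∘ ⊎-map (to (cycSucc-reflects k i j)) (to (cycSucc-reflects k j i)))
        (⊎-map (from (cycSucc-reflects k i j)) (from (cycSucc-reflects k j i)) ∘ cycAdj→succ)
    ⇔-∘ (withoutRight (λ zer≢zer → zer≢zer refl)
    ⇔-∘ if-nonzero (cycSucc k i j) (cycSucc k j i) (outSign-nonzero a) (outSign-nonzero a′))

C-columns : ∀ c e → c ≢ zer → e ≢ zer → ∀ k → AmbientColumns false k (Cgen c e k)
C-columns c e c≢0 e≢0 k = record { across = across′ ; within = within′ ; constantCharge = constantCharge′ }
  where
  lastEntry : Bool → Bool → Tri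
  lastEntry false false = c
  lastEntry true true = c
  lastEntry _ _ = e
  lastEntry-nonzero : ∀ a a′ → lastEntry a a′ ≢ zer
  lastEntry-nonzero false false = c≢0
  lastEntry-nonzero true true = c≢0
  lastEntry-nonzero false true = e≢0
  lastEntry-nonzero true false = e≢0
  lastEntry-diagonal : ∀ a → lastEntry a a ≡ c
  lastEntry-diagonal false = refl
  lastEntry-diagonal true = refl
  Diagonal : Fin k → Tri → Tri
  Diagonal i W = if toℕ i ≡ᵇ 0 then pos else if suc (toℕ i) ≡ᵇ k then W else zer
  linSucc-self : ∀ (i : Fin k) → linSucc i i ≡ false
  linSucc-self i = ≡ᵇ-false (1+n≢n {toℕ i})
  sameIndex : ∀ (i : Fin k) → (toℕ i ≡ᵇ toℕ i) ≡ true
  sameIndex i = to T-≡ (≡⇒≡ᵇ (toℕ i) (toℕ i) refl)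
  diagonal : ∀ i a a′ → Cgen c e k (i , a) (i , a′) ≡ Diagonal i (lastEntry a a′)
  diagonal i false false = trans (if-false (linSucc-self i)) (trans (if-false (linSucc-self i)) (if-true (sameIndex i)))
  diagonal i false true = trans (if-false (linSucc-self i)) (trans (if-false (linSucc-self i)) (if-true (sameIndex i)))
  diagonal i true false = trans (if-false (linSucc-self i)) (trans (if-false (linSucc-self i)) (if-true (sameIndex i)))
  diagonal i true true = trans (if-false (linSucc-self i)) (trans (if-false (linSucc-self i)) (if-true (sameIndex i)))
  within′ : ∀ i a a′ → (Cgen c e k (i , a) (i , a′) ≢ zer) ⇔ (Cgen c e k (i , a) (i , a) ≢ zer)
  within′ i a a′ =
    ⇔-sym (≢zer-cong (diagonal i a a))
    ⇔-∘ (⇔-sym (if-nonzero (toℕ i ≡ᵇ 0) (suc (toℕ i) ≡ᵇ k) (λ ()) (lastEntry-nonzero a a))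
    ⇔-∘ (if-nonzero (toℕ i ≡ᵇ 0) (suc (toℕ i) ≡ᵇ k) (λ ()) (lastEntry-nonzero a a′)
    ⇔-∘ ≢zer-cong (diagonal i a a′)))
  constantCharge′ : ∀ i a a′ → Cgen c e k (i , a) (i , a) ≡ Cgen c e k (i , a′) (i , a′)
  constantCharge′ i a a′ = trans (diagonal i a a)
    (trans (cong (Diagonal i) (trans (lastEntry-diagonal a) (sym (lastEntry-diagonal a′)))) (sym (diagonal i a′ a′)))
  across′ : ∀ i j a a′ → i ≢ j → (Cgen c e k (i , a) (j , a′) ≢ zer) ⇔ LinAdj i j
  across′ i j a a′ i≢j =
    (≡ᵇ-reflects _ _ ⊎-⇔ ≡ᵇ-reflects _ _)
    ⇔-∘ (withoutRight (λ nz → i≢j (toℕ-injective (≡ᵇ⇒≡ _ _ (if-zer-nonzero (toℕ i ≡ᵇ toℕ j) nz))))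
    ⇔-∘ if-nonzero (linSucc i j) (linSucc j i) (outSign-nonzero a) (outSign-nonzero a′))

ambientColumnMap : ∀ {n} {G : Matrix (Fin n)} →
  ((Σ[ k ∈ ℕ ] (3 ≤ k) × EquivConnSub G (T k))
    ⊎ (Σ[ k ∈ ℕ ] (2 ≤ k) × (EquivConnSub G (Cpp k) ⊎ EquivConnSub G (Cpm k)))) →
  Σ[ b ∈ Bool ] Σ[ k ∈ ℕ ] (2 ≤ k) × ColumnMap G b k × Connected G
ambientColumnMap (inj₁ (k , k≥3 , sub)) = true , k , k≥2 , inheritColumns k≥2 (T-columns k k≥2) sub
  where
  k≥2 : 2 ≤ k
  k≥2 = ≤-trans (n≤1+n 2) k≥3
ambientColumnMap (inj₂ (k , k≥2 , inj₁ sub)) = false , k , k≥2 , inheritColumns k≥2 (C-columns pos neg (λ ()) (λ ()) k) sub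
ambientColumnMap (inj₂ (k , k≥2 , inj₂ sub)) = false , k , k≥2 , inheritColumns k≥2 (C-columns neg pos (λ ()) (λ ()) k) sub

lemma4p1 : ∀ (n : ℕ) (G : Matrix (Fin n)) → IsCSG G →
    ((Σ[ k ∈ ℕ ] (3 ≤ k) × EquivConnSub G (T k))
      ⊎ (Σ[ k ∈ ℕ ] (2 ≤ k) × (EquivConnSub G (Cpp k) ⊎ EquivConnSub G (Cpm k)))) →
    ∀ (r : ℕ) → PathRank G r → 5 ≤ r →
      Profile G r
      × (∀ (k : ℕ) → Profile G k → k ≡ r)
      × (∀ (P Q : Profile G r) →
           Σ[ φ ∈ (Fin r → Fin r) ]
             Reorder (cycling P) r φ × (∀ x → col Q x ≡ φ (col P x)))
lemma4p1 _ _ symmetric ambient _ rank r≥5 with ambientColumnMap ambient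
... | _ , _ , k≥2 , M , connected =
  profileExists symmetric connected M k≥2 rank r≥5 ,
  (λ _ P → profileRank≡pathRank rank r≥5 P) ,
  (λ P Q → profilesUnique r≥5 P Q)
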